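{- Let $(A,+)$ be an abelian group, $\alpha,\beta\in A$, $n\ge 0$, and $M,N\in\mathcal{M}(n)$ (not necessarily distinct). 1. $s_{\alpha,\beta}(\mathcal{T}(M,l))=s_{\alpha,\beta}(\mathcal{T}(N,l))$ for all $l\ge 0$ if and only if $s_{\alpha,\beta}(M)=s_{\alpha,\beta}(N)$ and the sequences $seq_{\alpha,\beta}(M)$ and $seq_{\alpha,\beta}(N)$ are equal as multisets (ignoring order of terms). 2. $s_{\alpha,\beta}(\mathcal{T}(M,l))=s_{\beta,\alpha}(\mathcal{T}(N,l))$ for all $l\ge 0$ if and only if $s_{\alpha,\beta}(M)=s_{\beta,\alpha}(N)$ and the sequences $seq_{\alpha,\beta}(M)$ and $seq_{\beta,\alpha}(N)$ are equal as multisets.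
   Context: A matching on $[2n]$ is a partition of $[2n]$ into $n$ two-element blocks (edges); $\mathcal{M}(n)$ is the set of such matchings, $\mathcal{M}(0)=\{\emptyset\}$. Edges $A,B$ cross if $\min A<\min B<\max A<\max B$ or vice versa, and are nested if $\min A<\min B<\max B<\max A$ or vice versa; $cr(M),ne(M)$ count crossing and nested pairs, and $s_{\alpha,\beta}(M)=cr(M)\alpha+ne(M)\beta$. A matching $M\in\mathcal{M}(m)$ has $2m+1$ gaps: gap 1 before the point 1, gap $j$ between points $j-1$ and $j$ for $2\le j\le 2m$, gap $2m+1$ after $2m$. For $M\in\mathcal{M}(m)$ and $1\le i\le 2m+1$, inserting into gap $i$ a new first edge produces the matching in $\mathcal{M}(m+1)$ obtained by relabeling the vertices of $M$ order-preservingly by $\{2,\dots,2m+2\}\setminus\{i+1\}$ and adding $\{1,i+1\}$; these are the children of $M$. $\mathcal{T}(M,0)=\{M\}$ and $\mathcal{T}(M,l+1)$ is the set of children of members of $\mathcal{T}(M,l)$. For $x_1\dots x_l\in A^l$ and $y\in A$, $x_1\dots x_l+y$ denotes $(x_1+y)\dots(x_l+y)$. For $1\le i\le l$ define $R_{\alpha,\beta,i}(x_1x_2\dots x_l)=x_i\,(x_1x_2\dots x_i+x_i-x_1+\alpha)\,(x_ix_{i+1}\dots x_l+x_i-x_1+\beta)$ (concatenation; length $l+2$). The sequence $seq_{\alpha,\beta}(N)\in A^{2m+1}$ for $N\in\mathcal{M}(m)$ is defined recursively: $seq_{\alpha,\beta}(\emptyset)=(0_A)$, and if $N$ is obtained from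 $M$ by inserting a new first edge into gap $i$ of $M$, then $seq_{\alpha,\beta}(N)=R_{\alpha,\beta,i}(seq_{\alpha,\beta}(M))$. For a statistic $f$ and a set $Z$, $f(Z)$ is the multiset of values on $Z$ with multiplicities. -}

module Defs where

open import Level using (_⊔_)
open import Data.Bool using (Bool; true; false; _∧_; _∨_; if_then_else_)
open import Data.Nat using (ℕ; zero; suc; _+_; _*_; _∸_; _<_; _<ᵇ_)
open import Data.Product using (_×_; _,_; proj₁; proj₂)
open import Data.List using (List; []; _∷_; _++_; map; length; upTo; concatMap; take; drop; foldr)
open import Data.List.Relation.Unary.All using (All)
open import Data.List.Relation.Unary.Linked using (Linked)
open import Data.List.Relation.Binary.Permutation.Propositional using (_↭_)
open import Algebra.Bundles using (AbelianGroup)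

-- An edge {a,b} with a < b is the pair (a , b).  A matching
-- is represented canonically as the list of its edges sorted by their
-- minima (strictly increasing), so that the "first edge" is the head.

Edge : Set
Edge = ℕ × ℕ

Matching : Set
Matching = List Edge

vertices : Matching → List ℕ
vertices = concatMap (λ e → proj₁ e ∷ proj₂ e ∷ [])

points : ℕ → List ℕ
points n = map suc (upTo (2 * n))

IsMatching : ℕ → Matching → Set
IsMatching n M =
  All (λ e → proj₁ e < proj₂ e) M
  × Linked (λ e f → proj₁ e < proj₁ f) M
  × vertices M ↭ points n

crossesᵇ : Edge → Edge → Bool
crossesᵇ (a , b) (c , d) =
  ((a <ᵇ c) ∧ (c <ᵇ b) ∧ (b <ᵇ d)) ∨ ((c <ᵇ a) ∧ (a <ᵇ d) ∧ (d <ᵇ b))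

nestedᵇ : Edge → Edge → Bool
nestedᵇ (a , b) (c , d) =
  ((a <ᵇ c) ∧ (c <ᵇ d) ∧ (d <ᵇ b)) ∨ ((c <ᵇ a) ∧ (a <ᵇ b) ∧ (b <ᵇ d))

count : (Edge → Bool) → List Edge → ℕ
count p [] = 0
count p (x ∷ xs) = (if p x then 1 else 0) + count p xs

pairCount : (Edge → Edge → Bool) → Matching → ℕ
pairCount r [] = 0
pairCount r (e ∷ M) = count (r e) M + pairCount r M

cr : Matching → ℕ
cr = pairCount crossesᵇ

ne : Matching → ℕ
ne = pairCount nestedᵇ

-- Inserting a new first edge into gap i (1 ≤ i ≤ 2m+1) of M ∈ 𝓜(m):
-- the vertices 1..2m are relabelled order-preservingly onto
-- {2,...,2m+2} ∖ {i+1} (v ↦ v+1 if v < i, v ↦ v+2 otherwise), and the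
-- edge {1, i+1} is added.

relabel : ℕ → ℕ → ℕ
relabel i v = if v <ᵇ i then suc v else suc (suc v)

insertFirst : Matching → ℕ → Matching
insertFirst M i = (1 , suc i) ∷ map (λ e → relabel i (proj₁ e) , relabel i (proj₂ e)) M

gaps : Matching → List ℕ
gaps M = map suc (upTo (suc (2 * length M)))

children : Matching → List Matching
children M = map (insertFirst M) (gaps M)

-- 𝓣(M,l) (its members are pairwise distinct, so a list represents it)
T : Matching → ℕ → List Matching
T M zero = M ∷ []
T M (suc l) = concatMap children (T M l)

-- inverse of the relabelling: remove the first edge {1,b}
unrelabel : ℕ → ℕ → ℕ
unrelabel b v = if v <ᵇ b then v ∸ 1 else v ∸ 2

module WithGroup {c ℓ} (G : AbelianGroup c ℓ) where
  open AbelianGroup G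

  times : ℕ → Carrier → Carrier
  times zero x = ε
  times (suc n) x = x ∙ times n x

  s : Carrier → Carrier → Matching → Carrier
  s α β M = times (cr M) α ∙ times (ne M) β

  -- x_i (1-indexed), ε for out of range (never used for valid inputs)
  nth : ℕ → List Carrier → Carrier
  nth _ [] = ε
  nth zero (x ∷ xs) = ε
  nth (suc zero) (x ∷ xs) = x
  nth (suc (suc i)) (x ∷ xs) = nth (suc i) xs

  shift : Carrier → List Carrier → List Carrier
  shift y = map (λ x → x ∙ y)

  R : Carrier → Carrier → ℕ → List Carrier → List Carrier
  R α β i xs =
    nth i xs
      ∷ (shift ((nth i xs ∙ nth 1 xs ⁻¹) ∙ α) (take i xs)
        ++ shift ((nth i xs ∙ nth 1 xs ⁻¹) ∙ β) (drop (i ∸ 1) xs))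

  -- seq with fuel (fuel = number of edges): N = (1,b) ∷ rest is obtained by
  -- inserting a first edge into gap b−1 of the matching obtained from
  -- rest by undoing the relabelling.
  seqF : Carrier → Carrier → ℕ → Matching → List Carrier
  seqF α β zero _ = ε ∷ []
  seqF α β (suc k) [] = ε ∷ []
  seqF α β (suc k) ((a , b) ∷ rest) =
    R α β (b ∸ 1) (seqF α β k (map (λ e → unrelabel b (proj₁ e) , unrelabel b (proj₂ e)) rest))

  seq : Carrier → Carrier → Matching → List Carrier
  seq α β M = seqF α β (length M) M

{-# OPTIONS --safe #-}
module Submission where

-- Inserting a first edge into gap j of M adds to s(M) a weight that depends only on the
-- edges straddling, or lying before, gap j; seq M lists the s-values of the children of M,
-- and R computes the sequence of a child from that of M.  So s(T(M, l+1)) is obtained from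
-- s(M) and seq M by iterating R.  After translating by -s(M), one level of iteration is a
-- sum over the pivots xᵢ of the sequence, and the identity
--   h_{s+t+1}(x₁ … xₘ) = Σᵢ xᵢ · h_s(x₁ … xᵢ) · h_t(xᵢ … xₘ)
-- for complete homogeneous sums turns the l-fold iteration into a sum of translates
-- w · h_{k+1}(y) of the translated sequence y, with coefficients (k, w) that depend only
-- on α, β and l.  Hence s(T(M, l+1)) depends only on
-- s(M) and the multiset seq M, and exchanging α and β only permutes the coefficients.
-- Conversely, levels 0 and 1 of the tree are s(M) and seq M.

open import Level using (Level; _⊔_)
open import Function.Base using (_∘_)
open import Function.Bundles using (_⇔_; mk⇔; Equivalence)
open import Relation.Nullary using (contradiction)
open import Relation.Binary.Bundles using (Setoid)
open import Relation.Binary.PropositionalEquality as ≡ using (_≡_; _≢_)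
open import Algebra.Bundles using (AbelianGroup)
open import Data.Unit using (tt)
open import Data.Bool using (Bool; true; false; _∧_; not; if_then_else_)
open import Data.Bool.Properties using (T-≡; ∨-identityʳ; ∧-zeroʳ)
open import Data.Nat using (ℕ; zero; suc; _+_; _*_; _∸_; _≤_; _<_; s≤s; z≤n; _<ᵇ_)
open import Data.Nat.Properties
  using ( +-comm; +-suc; +-identityʳ; *-suc; *-cancelˡ-≡; suc-injective; m≤m+n; m+[n∸m]≡n; m+n∸m≡n; n∸n≡0
        ; +-∸-assoc; m≤n⇒m⊓n≡m; m≤n⇒∃[o]m+o≡n; m+n≤o⇒m≤o; m+n≤o⇒m≤o∸n; m≤n⇒m<n∨m≡n; <ᵇ⇒<; <⇒<ᵇ
        ; ≤-refl; ≤-trans; ≤-pred; <-trans; <-irrefl; <-≤-trans; <⇒≤; ≤⇒≯; ≤-<-connex; n≤1+n; m<n⇒m<1+n)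
open import Data.Product using (_×_; _,_; proj₁; proj₂; map₁; map₂; swap)
open import Data.Sum using (_⊎_; inj₁; inj₂)
open import Data.List using (List; []; _∷_; _++_; map; concatMap; length; upTo; downFrom; applyUpTo; take; drop)
open import Data.List.Properties
  using ( map-++; map-∘; map-upTo; map-concatMap; length-map; length-++; length-take; length-drop
        ; take-map; drop-map; take-[]; drop-[]; concatMap-++; concatMap-map; concatMap-cong; concatMap-pure
        ; ++-assoc; ++-identityʳ)
open import Data.List.Membership.Propositional using (_∈_)
open import Data.List.Membership.Propositional.Properties using (∈-++⁻)
open import Data.List.Relation.Unary.Any using (here; there)
open import Data.List.Relation.Unary.All as All using (All; []; _∷_)
import Data.List.Relation.Unary.All.Properties as AllP
open import Data.List.Relation.Unary.Linked using (Linked; []; [-]; _∷_)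
open import Data.List.Relation.Unary.Linked.Properties using (Linked⇒All)
open import Data.List.Relation.Binary.Permutation.Propositional
  using ()
  renaming ( _↭_ to _↭ₚ_; ↭-sym to ↭ₚ-sym; ↭-trans to ↭ₚ-trans; ↭-reflexive to ↭ₚ-reflexive
           ; module PermutationReasoning to PermutationReasoningₚ)
open import Data.List.Relation.Binary.Permutation.Propositional.Properties
  using (drop-mid; drop-∷; ↭-length) renaming (map⁺ to ↭ₚ-map⁺; ∈-resp-↭ to ∈-resp-↭ₚ)
open import Defs

private variable
  a b : Level
  A₁ : Set a
  A₂ : Set b

concatMap-concatMap : ∀ {c} {C : Set c} (f : A₂ → List C) (g : A₁ → List A₂) xs →
                      concatMap f (concatMap g xs) ≡ concatMap (concatMap f ∘ g) xs
concatMap-concatMap f g []       = ≡.refl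
concatMap-concatMap f g (x ∷ xs) =
  ≡.trans (concatMap-++ f (g x) _) (≡.cong (concatMap f (g x) ++_) (concatMap-concatMap f g xs))

concatMap-[] : ∀ (xs : List A₁) → concatMap (λ _ → []) xs ≡ [] {A = A₂}
concatMap-[] []       = ≡.refl
concatMap-[] (x ∷ xs) = concatMap-[] xs

antidiagonal : ℕ → List (ℕ × ℕ)
antidiagonal zero    = (0 , 0) ∷ []
antidiagonal (suc r) = (0 , suc r) ∷ map (map₁ suc) (antidiagonal r)

antidiagonal-suc : ∀ r → antidiagonal (suc r) ≡ map (map₂ suc) (antidiagonal r) ++ (suc r , 0) ∷ []
antidiagonal-suc zero    = ≡.refl
antidiagonal-suc (suc r) = ≡.cong ((0 , suc (suc r)) ∷_) (begin
  map (map₁ suc) (antidiagonal (suc r))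
    ≡⟨ ≡.cong (map (map₁ suc)) (antidiagonal-suc r) ⟩
  map (map₁ suc) (map (map₂ suc) (antidiagonal r) ++ (suc r , 0) ∷ [])
    ≡⟨ map-++ (map₁ suc) (map (map₂ suc) (antidiagonal r)) _ ⟩
  map (map₁ suc) (map (map₂ suc) (antidiagonal r)) ++ (suc (suc r) , 0) ∷ []
    ≡⟨ ≡.cong (_++ (suc (suc r) , 0) ∷ []) (≡.trans (≡.sym (map-∘ (antidiagonal r))) (map-∘ (antidiagonal r))) ⟩
  map (map₂ suc) (map (map₁ suc) (antidiagonal r)) ++ (suc (suc r) , 0) ∷ [] ∎)
  where open ≡.≡-Reasoning

positions : ℕ → List ℕ
positions n = map suc (upTo n)

positions-suc : ∀ n → positions (suc n) ≡ 1 ∷ map suc (positions n)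
positions-suc n = ≡.cong (1 ∷_) (≡.cong (map suc) (≡.sym (map-upTo suc n)))

All-positions : ∀ n → All (λ i → 1 ≤ i × i ≤ n) (positions n)
All-positions n = AllP.map⁺ (All.map (λ i<n → s≤s z≤n , i<n) (AllP.all-upTo n))

module BagProperties {c ℓ} (S : Setoid c ℓ) where
  open Setoid S using (Carrier)
  open import Data.List.Relation.Binary.Equality.Setoid S using (_≋_) renaming (++⁺ to ++⁺-≋)
  open import Data.List.Relation.Binary.Pointwise using ([])
  open import Data.List.Relation.Binary.Permutation.Setoid S
    using (_↭_; ↭-refl; ↭-sym; ↭-trans; ↭-reflexive; module PermutationReasoning)
  open import Data.List.Relation.Binary.Permutation.Setoid.Properties S
    using (++⁺; ++⁺ˡ; ++-comm; shifts)

  ++-medial : ∀ ws xs ys zs → (ws ++ xs) ++ (ys ++ zs) ↭ (ws ++ ys) ++ (xs ++ zs)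
  ++-medial ws xs ys zs = begin
    (ws ++ xs) ++ (ys ++ zs)  ≡⟨ ++-assoc ws xs _ ⟩
    ws ++ xs ++ ys ++ zs      ↭⟨ ++⁺ˡ ws (shifts xs ys) ⟩
    ws ++ ys ++ xs ++ zs      ≡⟨ ++-assoc ws ys _ ⟨
    (ws ++ ys) ++ (xs ++ zs)  ∎
    where open PermutationReasoning

  concatMap⁺ : ∀ {f g : A₁ → List Carrier} xs → (∀ x → f x ↭ g x) → concatMap f xs ↭ concatMap g xs
  concatMap⁺ []       f↭g = ↭-refl
  concatMap⁺ (x ∷ xs) f↭g = ++⁺ (f↭g x) (concatMap⁺ xs f↭g)

  concatMap⁺-≋ : ∀ {f g : A₁ → List Carrier} xs → (∀ x → f x ≋ g x) → concatMap f xs ≋ concatMap g xs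
  concatMap⁺-≋ []       f≋g = []
  concatMap⁺-≋ (x ∷ xs) f≋g = ++⁺-≋ (f≋g x) (concatMap⁺-≋ xs f≋g)

  concatMap⁺-≋-All : ∀ {p} {P : A₁ → Set p} {f g : A₁ → List Carrier} {xs} → All P xs →
                     (∀ {x} → P x → f x ≋ g x) → concatMap f xs ≋ concatMap g xs
  concatMap⁺-≋-All []         f≋g = []
  concatMap⁺-≋-All (Px ∷ Pxs) f≋g = ++⁺-≋ (f≋g Px) (concatMap⁺-≋-All Pxs f≋g)

  concatMap-++-distrib : ∀ (f g : A₁ → List Carrier) xs →
                         concatMap (λ x → f x ++ g x) xs ↭ concatMap f xs ++ concatMap g xs
  concatMap-++-distrib f g []       = ↭-refl
  concatMap-++-distrib f g (x ∷ xs) =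
    ↭-trans (++⁺ˡ (f x ++ g x) (concatMap-++-distrib f g xs)) (++-medial (f x) (g x) _ _)

  concatMap-comm : ∀ (h : A₁ → A₂ → List Carrier) xs ys →
                   concatMap (λ x → concatMap (h x) ys) xs ↭ concatMap (λ y → concatMap (λ x → h x y) xs) ys
  concatMap-comm h []       ys = ↭-reflexive (≡.sym (concatMap-[] ys))
  concatMap-comm h (x ∷ xs) ys =
    ↭-trans (++⁺ˡ (concatMap (h x) ys) (concatMap-comm h xs ys))
            (↭-sym (concatMap-++-distrib (h x) (λ y → concatMap (λ x → h x y) xs) ys))

  concatMap-antidiagonal-swap : ∀ r (f : ℕ × ℕ → List Carrier) →
                                concatMap f (antidiagonal r) ↭ concatMap (f ∘ swap) (antidiagonal r)
  concatMap-antidiagonal-swap zero    f = ↭-refl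
  concatMap-antidiagonal-swap (suc r) f = begin
    f (0 , suc r) ++ concatMap f (map (map₁ suc) D)
      ≡⟨ ≡.cong (f (0 , suc r) ++_) (concatMap-map f (map₁ suc) D) ⟩
    f (0 , suc r) ++ concatMap (f ∘ map₁ suc) D
      ↭⟨ ++⁺ˡ (f (0 , suc r)) (concatMap-antidiagonal-swap r (f ∘ map₁ suc)) ⟩
    f (0 , suc r) ++ concatMap (f ∘ swap ∘ map₂ suc) D
      ↭⟨ ++-comm (f (0 , suc r)) _ ⟩
    concatMap (f ∘ swap ∘ map₂ suc) D ++ f (0 , suc r)
      ≡⟨ ≡.cong (concatMap (f ∘ swap ∘ map₂ suc) D ++_) (++-identityʳ (f (0 , suc r))) ⟨
    concatMap (f ∘ swap ∘ map₂ suc) D ++ concatMap (f ∘ swap) ((suc r , 0) ∷ [])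
      ≡⟨ ≡.cong (_++ concatMap (f ∘ swap) ((suc r , 0) ∷ [])) (concatMap-map (f ∘ swap) (map₂ suc) D) ⟨
    concatMap (f ∘ swap) (map (map₂ suc) D) ++ concatMap (f ∘ swap) ((suc r , 0) ∷ [])
      ≡⟨ concatMap-++ (f ∘ swap) (map (map₂ suc) D) _ ⟨
    concatMap (f ∘ swap) (map (map₂ suc) D ++ (suc r , 0) ∷ [])
      ≡⟨ ≡.cong (concatMap (f ∘ swap)) (antidiagonal-suc r) ⟨
    concatMap (f ∘ swap) (antidiagonal (suc r)) ∎
    where
    open PermutationReasoning
    D : List (ℕ × ℕ)
    D = antidiagonal r

-- Complete homogeneous sums and iterated pivoting

module Multisets {c ℓ} (G : AbelianGroup c ℓ) where
  open AbelianGroup G renaming (Carrier to C; refl to ≈-refl; sym to ≈-sym)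
  open WithGroup G using (times; shift; nth)
  open import Algebra.Properties.CommutativeSemigroup commutativeSemigroup using (x∙yz≈y∙xz; xy∙z≈xz∙y)
  open import Data.List.Relation.Binary.Equality.Setoid setoid
    using (_≋_; ≋-refl; ≋-sym; ≋-trans; ≋-reflexive; ≋-setoid) renaming (++⁺ to ++⁺-≋)
  open import Data.List.Relation.Binary.Pointwise using ([]; _∷_)
  open import Data.List.Relation.Binary.Permutation.Setoid setoid
    using (_↭_; ↭-refl; ↭-sym; ↭-trans; ↭-reflexive; ↭-reflexive-≋; prep; module PermutationReasoning)
  import Data.List.Relation.Binary.Permutation.Homogeneous as Perm
  open import Data.List.Relation.Binary.Permutation.Setoid.Properties setoid
    using (++⁺; ++⁺ˡ; ++-comm; shifts; map⁺)
  open BagProperties setoid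

  infixr 6 _·_
  _·_ : C → List C → List C
  x · ys = map (x ∙_) ys

  ·-cong : ∀ {x y xs ys} → x ≈ y → xs ≋ ys → x · xs ≋ y · ys
  ·-cong x≈y []          = []
  ·-cong x≈y (u≈v ∷ eqs) = ∙-cong x≈y u≈v ∷ ·-cong x≈y eqs

  ·⁺ : ∀ {x y xs ys} → x ≈ y → xs ↭ ys → x · xs ↭ y · ys
  ·⁺ x≈y xs↭ys = ↭-trans (map⁺ setoid ∙-congˡ xs↭ys) (↭-reflexive-≋ (·-cong x≈y ≋-refl))

  shift-cong : ∀ {x y xs ys} → x ≈ y → xs ≋ ys → shift x xs ≋ shift y ys
  shift-cong x≈y []          = []
  shift-cong x≈y (u≈v ∷ eqs) = ∙-cong u≈v x≈y ∷ shift-cong x≈y eqs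

  shift⁺ : ∀ {x y xs ys} → x ≈ y → xs ↭ ys → shift x xs ↭ shift y ys
  shift⁺ x≈y xs↭ys = ↭-trans (map⁺ setoid ∙-congʳ xs↭ys) (↭-reflexive-≋ (shift-cong x≈y ≋-refl))

  ·-assoc : ∀ x y zs → x · y · zs ≋ (x ∙ y) · zs
  ·-assoc x y []       = []
  ·-assoc x y (z ∷ zs) = ≈-sym (assoc x y z) ∷ ·-assoc x y zs

  ·-comm : ∀ x y zs → x · y · zs ≋ y · x · zs
  ·-comm x y []       = []
  ·-comm x y (z ∷ zs) = x∙yz≈y∙xz x y z ∷ ·-comm x y zs

  ε· : ∀ xs → ε · xs ≋ xs
  ε· []       = []
  ε· (x ∷ xs) = identityˡ x ∷ ε· xs

  infixr 5 _⊕_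
  _⊕_ : List C → List C → List C
  xs ⊕ ys = concatMap (_· ys) xs

  ⊕-cong : ∀ {xs xs′ ys ys′} → xs ≋ xs′ → ys ≋ ys′ → xs ⊕ ys ≋ xs′ ⊕ ys′
  ⊕-cong []           ys≋ys′ = []
  ⊕-cong (x≈x′ ∷ eqs) ys≋ys′ = ++⁺-≋ (·-cong x≈x′ ys≋ys′) (⊕-cong eqs ys≋ys′)

  ε⊕ : ∀ ys → (ε ∷ []) ⊕ ys ≋ ys
  ε⊕ ys = ≋-trans (≋-reflexive (++-identityʳ (ε · ys))) (ε· ys)

  ·-⊕ : ∀ x ys zs → (x · ys) ⊕ zs ≋ x · (ys ⊕ zs)
  ·-⊕ x []       zs = []
  ·-⊕ x (y ∷ ys) zs = ≋-trans (++⁺-≋ (≋-sym (·-assoc x y zs)) (·-⊕ x ys zs))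
                              (≋-reflexive (≡.sym (map-++ (x ∙_) (y · zs) (ys ⊕ zs))))

  ⊕-· : ∀ x ys zs → ys ⊕ (x · zs) ≋ x · (ys ⊕ zs)
  ⊕-· x []       zs = []
  ⊕-· x (y ∷ ys) zs = ≋-trans (++⁺-≋ (·-comm y x zs) (⊕-· x ys zs))
                              (≋-reflexive (≡.sym (map-++ (x ∙_) (y · zs) (ys ⊕ zs))))

  -- hsums r xs is the multiset of sums of the r-element submultisets of xs, i.e. the
  -- complete homogeneous symmetric polynomial h_r(xs) read in the group ring of G.
  hsums : ℕ → List C → List C
  hsums zero    _        = ε ∷ []
  hsums (suc r) []       = []
  hsums (suc r) (x ∷ xs) = hsums (suc r) xs ++ x · hsums r (x ∷ xs)

  hsums-cong : ∀ r {xs ys} → xs ≋ ys → hsums r xs ≋ hsums r ys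
  hsums-cong zero    _          = ≋-refl
  hsums-cong (suc r) []         = []
  hsums-cong (suc r) (x≈y ∷ eqs) =
    ++⁺-≋ (hsums-cong (suc r) eqs) (·-cong x≈y (hsums-cong r (x≈y ∷ eqs)))

  hsums-prep : ∀ {x y xs ys} → x ≈ y → (∀ r → hsums r xs ↭ hsums r ys) →
               ∀ r → hsums r (x ∷ xs) ↭ hsums r (y ∷ ys)
  hsums-prep x≈y xs↭ys zero    = ↭-refl
  hsums-prep x≈y xs↭ys (suc r) = ++⁺ (xs↭ys (suc r)) (·⁺ x≈y (hsums-prep x≈y xs↭ys r))

  hsums-swap : ∀ r x y zs → hsums r (x ∷ y ∷ zs) ↭ hsums r (y ∷ x ∷ zs)
  hsums-swap zero          x y zs = ↭-refl
  hsums-swap (suc zero)    x y zs = begin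
    (hsums 1 zs ++ y · (ε ∷ [])) ++ x · (ε ∷ [])  ≡⟨ ++-assoc (hsums 1 zs) _ _ ⟩
    hsums 1 zs ++ (y ∙ ε) ∷ (x ∙ ε) ∷ []       ↭⟨ ++⁺ˡ (hsums 1 zs) (++-comm ((y ∙ ε) ∷ []) _) ⟩
    hsums 1 zs ++ (x ∙ ε) ∷ (y ∙ ε) ∷ []       ≡⟨ ++-assoc (hsums 1 zs) _ _ ⟨
    (hsums 1 zs ++ x · (ε ∷ [])) ++ y · (ε ∷ [])  ∎
    where open PermutationReasoning
  hsums-swap (suc (suc r)) x y zs = begin
    (Z ++ y · Y) ++ x · hsums (suc r) (x ∷ y ∷ zs)
      ↭⟨ ++⁺ˡ (Z ++ y · Y) (·⁺ ≈-refl (hsums-swap (suc r) x y zs)) ⟩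
    (Z ++ y · Y) ++ x · (X ++ y · hsums r (y ∷ x ∷ zs))
      ≡⟨ ≡.cong ((Z ++ y · Y) ++_) (map-++ (x ∙_) X _) ⟩
    (Z ++ y · Y) ++ (x · X ++ x · y · hsums r (y ∷ x ∷ zs))
      ↭⟨ ++-medial Z (y · Y) (x · X) _ ⟩
    (Z ++ x · X) ++ (y · Y ++ x · y · hsums r (y ∷ x ∷ zs))
      ↭⟨ ++⁺ˡ (Z ++ x · X) (++⁺ˡ (y · Y) (↭-reflexive-≋ (·-comm x y _))) ⟩
    (Z ++ x · X) ++ (y · Y ++ y · x · hsums r (y ∷ x ∷ zs))
      ↭⟨ ++⁺ˡ (Z ++ x · X) (++⁺ˡ (y · Y) (·⁺ ≈-refl (·⁺ ≈-refl (hsums-swap r y x zs)))) ⟩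
    (Z ++ x · X) ++ (y · Y ++ y · x · hsums r (x ∷ y ∷ zs))
      ≡⟨ ≡.cong ((Z ++ x · X) ++_) (map-++ (y ∙_) Y _) ⟨
    (Z ++ x · X) ++ y · hsums (suc r) (x ∷ y ∷ zs)
      ↭⟨ ++⁺ˡ (Z ++ x · X) (·⁺ ≈-refl (hsums-swap (suc r) x y zs)) ⟩
    (Z ++ x · X) ++ y · hsums (suc r) (y ∷ x ∷ zs) ∎
    where
    open PermutationReasoning
    Z : List C
    Z = hsums (suc (suc r)) zs
    X : List C
    X = hsums (suc r) (x ∷ zs)
    Y : List C
    Y = hsums (suc r) (y ∷ zs)

  hsums-↭ : ∀ {xs ys} → xs ↭ ys → ∀ r → hsums r xs ↭ hsums r ys
  hsums-↭ (Perm.refl xs≋ys)      r = ↭-reflexive-≋ (hsums-cong r xs≋ys)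
  hsums-↭ (Perm.prep x≈y xs↭ys)    = hsums-prep x≈y (hsums-↭ xs↭ys)
  hsums-↭ {x ∷ y ∷ xs} (Perm.swap x≈x′ y≈y′ xs↭ys) r =
    ↭-trans (hsums-swap r x y xs) (hsums-prep y≈y′ (hsums-prep x≈x′ (hsums-↭ xs↭ys)) r)
  hsums-↭ (Perm.trans xs↭ys ys↭zs) r = ↭-trans (hsums-↭ xs↭ys r) (hsums-↭ ys↭zs r)

  convolution : ℕ → List C → List C → List C
  convolution r xs ys = concatMap (λ st → hsums (proj₁ st) xs ⊕ hsums (proj₂ st) ys) (antidiagonal r)

  convolution-[] : ∀ r ys → convolution r [] ys ≋ hsums r ys
  convolution-[] zero    ys = ≋-trans (≋-reflexive (++-identityʳ _)) (ε⊕ (ε ∷ []))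
  convolution-[] (suc r) ys = ≋-trans (≋-reflexive (≡.trans (≡.cong (((ε ∷ []) ⊕ hsums (suc r) ys) ++_) (≡.trans
      (concatMap-map (λ st → hsums (proj₁ st) [] ⊕ hsums (proj₂ st) ys) (map₁ suc) (antidiagonal r))
      (concatMap-[] (antidiagonal r)))) (++-identityʳ _)))
    (ε⊕ (hsums (suc r) ys))

  convolution-∷ : ∀ r x xs ys →
                  convolution (suc r) (x ∷ xs) ys ↭ convolution (suc r) xs ys ++ x · convolution r (x ∷ xs) ys
  convolution-∷ r x xs ys = begin
    E ++ concatMap (term (x ∷ xs)) (map (map₁ suc) D)
      ≡⟨ ≡.cong (E ++_) (concatMap-map (term (x ∷ xs)) (map₁ suc) D) ⟩
    E ++ concatMap (term (x ∷ xs) ∘ map₁ suc) D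
      ↭⟨ ++⁺ˡ E (concatMap⁺ D (λ st → ↭-reflexive-≋ (split st))) ⟩
    E ++ concatMap (λ st → term xs (map₁ suc st) ++ x · term (x ∷ xs) st) D
      ↭⟨ ++⁺ˡ E (concatMap-++-distrib (term xs ∘ map₁ suc) (λ st → x · term (x ∷ xs) st) D) ⟩
    E ++ (concatMap (term xs ∘ map₁ suc) D ++ concatMap (λ st → x · term (x ∷ xs) st) D)
      ≡⟨ ≡.cong₂ (λ u v → E ++ (u ++ v)) (concatMap-map (term xs) (map₁ suc) D)
                                         (map-concatMap (x ∙_) (term (x ∷ xs)) D) ⟨
    E ++ (concatMap (term xs) (map (map₁ suc) D) ++ x · convolution r (x ∷ xs) ys)
      ≡⟨ ++-assoc E _ _ ⟨
    convolution (suc r) xs ys ++ x · convolution r (x ∷ xs) ys ∎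
    where
    open PermutationReasoning
    D : List (ℕ × ℕ)
    D = antidiagonal r
    E : List C
    E = (ε ∷ []) ⊕ hsums (suc r) ys
    term : List C → ℕ × ℕ → List C
    term zs st = hsums (proj₁ st) zs ⊕ hsums (proj₂ st) ys
    split : ∀ st → term (x ∷ xs) (map₁ suc st) ≋ term xs (map₁ suc st) ++ x · term (x ∷ xs) st
    split (s , t) = ≋-trans (≋-reflexive (concatMap-++ (_· hsums t ys) (hsums (suc s) xs) _))
                            (++⁺-≋ ≋-refl (·-⊕ x (hsums s (x ∷ xs)) (hsums t ys)))

  hsums-++ : ∀ xs r ys → hsums r (xs ++ ys) ↭ convolution r xs ys
  hsums-++ xs       zero    ys = ↭-sym (↭-reflexive-≋ (convolution-[] zero ys))
  hsums-++ []       (suc r) ys = ↭-sym (↭-reflexive-≋ (convolution-[] (suc r) ys))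
  hsums-++ (x ∷ xs) (suc r) ys =
    ↭-trans (++⁺ (hsums-++ xs (suc r) ys) (·⁺ ≈-refl (hsums-++ (x ∷ xs) r ys)))
            (↭-sym (convolution-∷ r x xs ys))

  hsums-· : ∀ r x ys → hsums r (x · ys) ≋ times r x · hsums r ys
  hsums-· zero    x ys       = ≈-sym (identityˡ ε) ∷ []
  hsums-· (suc r) x []       = []
  hsums-· (suc r) x (y ∷ ys) = ≋-trans (++⁺-≋ (hsums-· (suc r) x ys) (begin
    (x ∙ y) · hsums r (x · (y ∷ ys))     ≈⟨ ·-cong ≈-refl (hsums-· r x (y ∷ ys)) ⟩
    (x ∙ y) · times r x · Y              ≈⟨ ·-assoc (x ∙ y) (times r x) Y ⟩
    ((x ∙ y) ∙ times r x) · Y            ≈⟨ ·-cong (xy∙z≈xz∙y x y (times r x)) ≋-refl ⟩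
    times (suc r) x ∙ y · Y              ≈⟨ ·-assoc (times (suc r) x) y Y ⟨
    times (suc r) x · y · Y              ∎))
    (≋-reflexive (≡.sym (map-++ (times (suc r) x ∙_) (hsums (suc r) ys) _)))
    where
    open import Relation.Binary.Reasoning.Setoid ≋-setoid
    Y : List C
    Y = hsums r (y ∷ ys)
    
  hsums-ε∷ : ∀ r xs → hsums r (ε ∷ xs) ↭ concatMap (λ q → hsums q xs) (downFrom (suc r))
  hsums-ε∷ zero    xs = ↭-reflexive (≡.sym (++-identityʳ (ε ∷ [])))
  hsums-ε∷ (suc r) xs = ++⁺ˡ (hsums (suc r) xs) (↭-trans (↭-reflexive-≋ (ε· _)) (hsums-ε∷ r xs))

  hsums-one : ∀ xs → xs ↭ hsums 1 xs
  hsums-one []       = ↭-refl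
  hsums-one (x ∷ xs) = ↭-trans (prep (≈-sym (identityʳ x)) (hsums-one xs)) (++-comm ((x ∙ ε) ∷ []) (hsums 1 xs))

  -- The pivots of x₁ … xₘ are the triples (x₁ … xᵢ , xᵢ , xᵢ … xₘ); as in R, the pivot
  -- belongs to both halves.
  record Pivot : Set c where
    constructor mkPivot
    field
      front : List C
      pivot : C
      back  : List C
  open Pivot public

  extend : C → Pivot → Pivot
  extend x p = mkPivot (x ∷ front p) (pivot p) (back p)

  pivots : List C → List Pivot
  pivots []       = []
  pivots (x ∷ xs) = mkPivot (x ∷ []) x (x ∷ xs) ∷ map (extend x) (pivots xs)

  pivotAt : List C → ℕ → Pivot
  pivotAt ys i = mkPivot (take i ys) (nth i ys) (drop (i ∸ 1) ys)

  pivots-positions : ∀ ys → pivots ys ≡ map (pivotAt ys) (positions (length ys))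
  pivots-positions []       = ≡.refl
  pivots-positions (y ∷ ys) = begin
    mkPivot (y ∷ []) y (y ∷ ys) ∷ map (extend y) (pivots ys)
      ≡⟨ ≡.cong (λ ps → mkPivot (y ∷ []) y (y ∷ ys) ∷ map (extend y) ps) (pivots-positions ys) ⟩
    mkPivot (y ∷ []) y (y ∷ ys) ∷ map (extend y) (map (pivotAt ys) (map suc (upTo n)))
      ≡⟨ ≡.cong (_ ∷_) (≡.trans (≡.sym (map-∘ (map suc (upTo n)))) (≡.sym (map-∘ (upTo n)))) ⟩
    mkPivot (y ∷ []) y (y ∷ ys) ∷ map (extend y ∘ pivotAt ys ∘ suc) (upTo n)
      ≡⟨ ≡.cong (_ ∷_) (≡.trans (map-∘ (upTo n)) (map-∘ (map suc (upTo n)))) ⟩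
    map (pivotAt (y ∷ ys)) (1 ∷ map suc (positions n))
      ≡⟨ ≡.cong (map (pivotAt (y ∷ ys))) (positions-suc n) ⟨
    map (pivotAt (y ∷ ys)) (positions (suc n)) ∎
    where
    open ≡.≡-Reasoning
    n : ℕ
    n = length ys

  pivotTerm : ℕ → ℕ → Pivot → List C
  pivotTerm s t p = pivot p · (hsums s (front p) ⊕ hsums t (back p))

  pivotTerm-extend : ∀ s t x p →
                     pivotTerm (suc s) t (extend x p) ≋ pivotTerm (suc s) t p ++ x · pivotTerm s t (extend x p)
  pivotTerm-extend s t x (mkPivot P v S) = ≋-trans
    (≋-reflexive (≡.trans (≡.cong (v ·_) (concatMap-++ (_· hsums t S) (hsums (suc s) P) _))
                          (map-++ (v ∙_) (hsums (suc s) P ⊕ hsums t S) _)))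
    (++⁺-≋ ≋-refl (≋-trans (·-cong ≈-refl (·-⊕ x (hsums s (x ∷ P)) (hsums t S))) (·-comm v x _)))

  -- Sort the indices of an (s+t+1)-element submultiset; its (s+1)-st index is the pivot.
  pivots-convolution : ∀ s t xs → concatMap (pivotTerm s t) (pivots xs) ↭ hsums (suc (s + t)) xs
  pivots-convolution s       t []       = ↭-refl
  pivots-convolution zero    t (x ∷ xs) = begin
    x · ((ε ∷ []) ⊕ hsums t (x ∷ xs)) ++ concatMap (pivotTerm 0 t) (map (extend x) (pivots xs))
      ≡⟨ ≡.cong (x · ((ε ∷ []) ⊕ hsums t (x ∷ xs)) ++_) (concatMap-map (pivotTerm 0 t) (extend x) (pivots xs)) ⟩
    x · ((ε ∷ []) ⊕ hsums t (x ∷ xs)) ++ concatMap (pivotTerm 0 t) (pivots xs)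
      ↭⟨ ++⁺ (↭-reflexive-≋ (·-cong ≈-refl (ε⊕ _))) (pivots-convolution 0 t xs) ⟩
    x · hsums t (x ∷ xs) ++ hsums (suc t) xs
      ↭⟨ ++-comm (x · hsums t (x ∷ xs)) _ ⟩
    hsums (suc t) (x ∷ xs) ∎
    where open PermutationReasoning
  pivots-convolution (suc s) t (x ∷ xs) = begin
    x · (x · hsums s (x ∷ []) ⊕ Hₜ) ++ concatMap (pivotTerm (suc s) t) (map (extend x) ps)
      ↭⟨ ++⁺ (↭-reflexive-≋ (·-cong ≈-refl (·-⊕ x (hsums s (x ∷ [])) Hₜ))) extended ⟩
    x · pivotTerm s t first ++ (Fs ++ x · concatMap (pivotTerm s t) (map (extend x) ps))
      ↭⟨ shifts (x · pivotTerm s t first) Fs ⟩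
    Fs ++ x · pivotTerm s t first ++ x · concatMap (pivotTerm s t) (map (extend x) ps)
      ≡⟨ ≡.cong (Fs ++_) (map-++ (x ∙_) (pivotTerm s t first) _) ⟨
    Fs ++ x · concatMap (pivotTerm s t) (pivots (x ∷ xs))
      ↭⟨ ++⁺ (pivots-convolution (suc s) t xs) (·⁺ ≈-refl (pivots-convolution s t (x ∷ xs))) ⟩
    hsums (suc (suc s + t)) (x ∷ xs) ∎
    where
    open PermutationReasoning
    ps : List Pivot
    ps = pivots xs
    Hₜ : List C
    Hₜ = hsums t (x ∷ xs)
    first : Pivot
    first = mkPivot (x ∷ []) x (x ∷ xs)
    Fs : List C
    Fs = concatMap (pivotTerm (suc s) t) ps
    extended : concatMap (pivotTerm (suc s) t) (map (extend x) ps) ↭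
               Fs ++ x · concatMap (pivotTerm s t) (map (extend x) ps)
    extended = begin
      concatMap (pivotTerm (suc s) t) (map (extend x) ps)
        ≡⟨ concatMap-map (pivotTerm (suc s) t) (extend x) ps ⟩
      concatMap (pivotTerm (suc s) t ∘ extend x) ps
        ↭⟨ concatMap⁺ ps (λ p → ↭-reflexive-≋ (pivotTerm-extend s t x p)) ⟩
      concatMap (λ p → pivotTerm (suc s) t p ++ x · pivotTerm s t (extend x p)) ps
        ↭⟨ concatMap-++-distrib (pivotTerm (suc s) t) (λ p → x · pivotTerm s t (extend x p)) ps ⟩
      Fs ++ concatMap (λ p → x · pivotTerm s t (extend x p)) ps
        ≡⟨ ≡.cong (Fs ++_) (map-concatMap (x ∙_) (pivotTerm s t ∘ extend x) ps) ⟨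
      Fs ++ x · concatMap (pivotTerm s t ∘ extend x) ps
        ≡⟨ ≡.cong (λ zs → Fs ++ x · zs) (concatMap-map (pivotTerm s t) (extend x) ps) ⟨
      Fs ++ x · concatMap (pivotTerm s t) (map (extend x) ps) ∎

  -- levels l xs is the multiset of s-values at depth l+1 below a matching whose
  -- sequence is xs, normalised so that the matching itself has s-value ε.
  module Levels (α β : C) where
    child : Pivot → List C
    child p = ε ∷ α · front p ++ β · back p

    levels : ℕ → List C → List C
    levels zero    xs = xs
    levels (suc l) xs = concatMap (λ p → pivot p · levels l (child p)) (pivots xs)

    weight : ℕ × ℕ → C
    weight (s , t) = times s α ∙ times t β

    hterm : ℕ × C → List C → List C
    hterm (k , w) xs = w · hsums (suc k) xs

    degreeWeight : ℕ × ℕ → ℕ × C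
    degreeWeight st = proj₁ st + proj₂ st , weight st

    childExpansion : ℕ → List (ℕ × C)
    childExpansion k = concatMap (λ q → map degreeWeight (antidiagonal q)) (downFrom (suc (suc k)))

    scaledExpansion : ℕ × C → List (ℕ × C)
    scaledExpansion (k , w) = map (map₂ (w ∙_)) (childExpansion k)

    coefficients : ℕ → List (ℕ × C)
    coefficients zero    = (0 , ε) ∷ []
    coefficients (suc l) = concatMap scaledExpansion (coefficients l)

    closedForm : ℕ → List C → List C
    closedForm l xs = concatMap (λ kw → hterm kw xs) (coefficients l)

    hsums-split : ∀ q P S → hsums q (α · P ++ β · S) ↭
                  concatMap (λ st → weight st · (hsums (proj₁ st) P ⊕ hsums (proj₂ st) S)) (antidiagonal q)
    hsums-split q P S = ↭-trans (hsums-++ (α · P) q (β · S))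
      (↭-reflexive-≋ (concatMap⁺-≋ (antidiagonal q) λ (s , t) → begin
        hsums s (α · P) ⊕ hsums t (β · S)                    ≈⟨ ⊕-cong (hsums-· s α P) (hsums-· t β S) ⟩
        (times s α · hsums s P) ⊕ (times t β · hsums t S)    ≈⟨ ·-⊕ (times s α) (hsums s P) _ ⟩
        times s α · (hsums s P ⊕ times t β · hsums t S)      ≈⟨ ·-cong ≈-refl (⊕-· (times t β) (hsums s P) _) ⟩
        times s α · times t β · (hsums s P ⊕ hsums t S)      ≈⟨ ·-assoc (times s α) (times t β) _ ⟩
        weight (s , t) · (hsums s P ⊕ hsums t S)             ∎))
      where open import Relation.Binary.Reasoning.Setoid ≋-setoid

    weightedTerm : ℕ × ℕ → Pivot → List C
    weightedTerm st p = weight st · pivotTerm (proj₁ st) (proj₂ st) p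

    pivot-hsums-child : ∀ k p → pivot p · hsums (suc k) (child p) ↭
      concatMap (λ q → concatMap (λ st → weightedTerm st p) (antidiagonal q)) (downFrom (suc (suc k)))
    pivot-hsums-child k p@(mkPivot P v S) = begin
      v · hsums (suc k) (ε ∷ α · P ++ β · S)
        ↭⟨ ·⁺ ≈-refl (hsums-ε∷ (suc k) (α · P ++ β · S)) ⟩
      v · concatMap (λ q → hsums q (α · P ++ β · S)) ds
        ↭⟨ ·⁺ ≈-refl (concatMap⁺ ds (λ q → hsums-split q P S)) ⟩
      v · concatMap (λ q → concatMap split (antidiagonal q)) ds
        ≡⟨ map-concatMap (v ∙_) (λ q → concatMap split (antidiagonal q)) ds ⟩
      concatMap (λ q → v · concatMap split (antidiagonal q)) ds
        ↭⟨ concatMap⁺ ds (λ q → ↭-trans (↭-reflexive (map-concatMap (v ∙_) split (antidiagonal q)))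
                                        (concatMap⁺ (antidiagonal q) (λ st → ↭-reflexive-≋ (·-comm v (weight st) _)))) ⟩
      concatMap (λ q → concatMap (λ st → weightedTerm st p) (antidiagonal q)) ds ∎
      where
      open PermutationReasoning
      ds : List ℕ
      ds = downFrom (suc (suc k))
      split : ℕ × ℕ → List C
      split st = weight st · (hsums (proj₁ st) P ⊕ hsums (proj₂ st) S)

    pivots-hsums-child : ∀ k xs → concatMap (λ p → pivot p · hsums (suc k) (child p)) (pivots xs) ↭
                                  concatMap (λ jw → hterm jw xs) (childExpansion k)
    pivots-hsums-child k xs = begin
      concatMap (λ p → pivot p · hsums (suc k) (child p)) (pivots xs)
        ↭⟨ concatMap⁺ (pivots xs) (pivot-hsums-child k) ⟩
      concatMap (λ p → concatMap (λ q → concatMap (λ st → weightedTerm st p) (antidiagonal q)) ds) (pivots xs)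
        ↭⟨ concatMap-comm (λ p q → concatMap (λ st → weightedTerm st p) (antidiagonal q)) (pivots xs) ds ⟩
      concatMap (λ q → concatMap (λ p → concatMap (λ st → weightedTerm st p) (antidiagonal q)) (pivots xs)) ds
        ↭⟨ concatMap⁺ ds (λ q → ↭-trans (concatMap-comm (λ p st → weightedTerm st p) (pivots xs) (antidiagonal q))
                                        (concatMap⁺ (antidiagonal q) convolve)) ⟩
      concatMap (λ q → concatMap (λ st → weight st · hsums (suc (proj₁ st + proj₂ st)) xs) (antidiagonal q)) ds
        ≡⟨ ≡.trans (concatMap-concatMap (λ jw → hterm jw xs) (λ q → map degreeWeight (antidiagonal q)) ds)
                   (concatMap-cong (λ q → concatMap-map (λ jw → hterm jw xs) degreeWeight (antidiagonal q)) ds) ⟨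
      concatMap (λ jw → hterm jw xs) (childExpansion k) ∎
      where
      open PermutationReasoning
      ds : List ℕ
      ds = downFrom (suc (suc k))
      convolve : ∀ st → concatMap (weightedTerm st) (pivots xs) ↭ weight st · hsums (suc (proj₁ st + proj₂ st)) xs
      convolve (s , t) = ↭-trans (↭-reflexive (≡.sym (map-concatMap (weight (s , t) ∙_) (pivotTerm s t) (pivots xs))))
                                 (·⁺ ≈-refl (pivots-convolution s t xs))

    levels-closedForm : ∀ l xs → levels l xs ↭ closedForm l xs
    levels-closedForm zero    xs =
      ↭-trans (hsums-one xs) (↭-sym (↭-reflexive-≋ (≋-trans (≋-reflexive (++-identityʳ _)) (ε· _))))
    levels-closedForm (suc l) xs = begin
      concatMap (λ p → pivot p · levels l (child p)) ps
        ↭⟨ concatMap⁺ ps (λ p → ↭-trans (·⁺ ≈-refl (levels-closedForm l (child p))) (distribute p)) ⟩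
      concatMap (λ p → concatMap (λ kw → term kw p) cs) ps
        ↭⟨ concatMap-comm (λ p kw → term kw p) ps cs ⟩
      concatMap (λ kw → concatMap (λ p → term kw p) ps) cs
        ↭⟨ concatMap⁺ cs expand ⟩
      concatMap (λ kw → concatMap (λ jw → hterm (map₂ (proj₂ kw ∙_) jw) xs) (childExpansion (proj₁ kw))) cs
        ≡⟨ ≡.trans (concatMap-concatMap (λ kw → hterm kw xs) scaledExpansion cs)
                   (concatMap-cong (λ (k , w) → concatMap-map (λ jw → hterm jw xs) (map₂ (w ∙_)) (childExpansion k)) cs) ⟨
      closedForm (suc l) xs ∎
      where
      open PermutationReasoning
      ps : List Pivot
      ps = pivots xs
      cs : List (ℕ × C)
      cs = coefficients l
      term : ℕ × C → Pivot → List C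
      term (k , w) p = w · pivot p · hsums (suc k) (child p)
      distribute : ∀ p → pivot p · closedForm l (child p) ↭ concatMap (λ kw → term kw p) cs
      distribute p = ↭-trans (↭-reflexive (map-concatMap (pivot p ∙_) _ cs))
                             (concatMap⁺ cs (λ kw → ↭-reflexive-≋ (·-comm (pivot p) (proj₂ kw) _)))
      expand : ∀ kw → concatMap (term kw) ps ↭
               concatMap (λ jw → hterm (map₂ (proj₂ kw ∙_) jw) xs) (childExpansion (proj₁ kw))
      expand (k , w) = begin
        concatMap (term (k , w)) ps
          ≡⟨ map-concatMap (w ∙_) (λ p → pivot p · hsums (suc k) (child p)) ps ⟨
        w · concatMap (λ p → pivot p · hsums (suc k) (child p)) ps
          ↭⟨ ·⁺ ≈-refl (pivots-hsums-child k xs) ⟩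
        w · concatMap (λ jw → hterm jw xs) (childExpansion k)
          ≡⟨ map-concatMap (w ∙_) (λ jw → hterm jw xs) (childExpansion k) ⟩
        concatMap (λ jw → w · hterm jw xs) (childExpansion k)
          ↭⟨ concatMap⁺ (childExpansion k) (λ jw → ↭-reflexive-≋ (·-assoc w (proj₂ jw) _)) ⟩
        concatMap (λ jw → hterm (map₂ (w ∙_) jw) xs) (childExpansion k) ∎

    closedForm-↭ : ∀ l {xs ys} → xs ↭ ys → closedForm l xs ↭ closedForm l ys
    closedForm-↭ l xs↭ys = concatMap⁺ (coefficients l) (λ kw → ·⁺ ≈-refl (hsums-↭ xs↭ys (suc (proj₁ kw))))

  open Levels public

  RespectsWeight : (ℕ × C → List C) → Set (c ⊔ ℓ)
  RespectsWeight f = ∀ k {w w′} → w ≈ w′ → f (k , w) ↭ f (k , w′)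

  concatMap-childExpansion : ∀ α β k (f : ℕ × C → List C) → concatMap f (childExpansion α β k) ≡
    concatMap (λ q → concatMap (f ∘ degreeWeight α β) (antidiagonal q)) (downFrom (suc (suc k)))
  concatMap-childExpansion α β k f =
    ≡.trans (concatMap-concatMap f (λ q → map (degreeWeight α β) (antidiagonal q)) (downFrom (suc (suc k))))
            (concatMap-cong (λ q → concatMap-map f (degreeWeight α β) (antidiagonal q)) (downFrom (suc (suc k))))

  childExpansion-swap : ∀ α β k f → RespectsWeight f →
                        concatMap f (childExpansion α β k) ↭ concatMap f (childExpansion β α k)
  childExpansion-swap α β k f f-resp = begin
    concatMap f (childExpansion α β k)
      ≡⟨ concatMap-childExpansion α β k f ⟩
    concatMap (λ q → concatMap (f ∘ degreeWeight α β) (antidiagonal q)) ds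
      ↭⟨ concatMap⁺ ds (λ q → ↭-trans (concatMap-antidiagonal-swap q (f ∘ degreeWeight α β))
                                      (concatMap⁺ (antidiagonal q) swapped)) ⟩
    concatMap (λ q → concatMap (f ∘ degreeWeight β α) (antidiagonal q)) ds
      ≡⟨ concatMap-childExpansion β α k f ⟨
    concatMap f (childExpansion β α k) ∎
    where
    open PermutationReasoning
    ds : List ℕ
    ds = downFrom (suc (suc k))
    swapped : ∀ st → f (degreeWeight α β (swap st)) ↭ f (degreeWeight β α st)
    swapped (s , t) rewrite +-comm t s = f-resp (s + t) (comm (times t α) (times s β))

  coefficients-swap : ∀ α β l f → RespectsWeight f →
                      concatMap f (coefficients α β l) ↭ concatMap f (coefficients β α l)
  coefficients-swap α β zero    f f-resp = ↭-refl
  coefficients-swap α β (suc l) f f-resp = begin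
    concatMap f (coefficients α β (suc l))
      ≡⟨ unfold α β ⟩
    concatMap (shifted α β) (coefficients α β l)
      ↭⟨ coefficients-swap α β l (shifted α β) (λ k w≈w′ → concatMap⁺ (childExpansion α β k)
                                                  (λ jw → f-resp (proj₁ jw) (∙-congʳ w≈w′))) ⟩
    concatMap (shifted α β) (coefficients β α l)
      ↭⟨ concatMap⁺ (coefficients β α l) (λ kw → childExpansion-swap α β (proj₁ kw) (f ∘ map₂ (proj₂ kw ∙_))
                                                    (λ k w≈w′ → f-resp k (∙-congˡ w≈w′))) ⟩
    concatMap (shifted β α) (coefficients β α l)
      ≡⟨ unfold β α ⟨
    concatMap f (coefficients β α (suc l)) ∎
    where
    open PermutationReasoning
    shifted : C → C → ℕ × C → List C
    shifted a b kw = concatMap (f ∘ map₂ (proj₂ kw ∙_)) (childExpansion a b (proj₁ kw))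
    unfold : ∀ a b → concatMap f (coefficients a b (suc l)) ≡ concatMap (shifted a b) (coefficients a b l)
    unfold a b = ≡.trans (concatMap-concatMap f (scaledExpansion a b) (coefficients a b l))
      (concatMap-cong (λ (k , w) → concatMap-map f (map₂ (w ∙_)) (childExpansion a b k)) (coefficients a b l))

  closedForm-swap : ∀ α β l xs → closedForm α β l xs ↭ closedForm β α l xs
  closedForm-swap α β l xs = coefficients-swap α β l (λ kw → hterm α β kw xs) (λ k w≈w′ → ·⁺ w≈w′ ↭-refl)

-- Inserting a new first edge

<ᵇ-true : ∀ {m n} → m < n → (m <ᵇ n) ≡ true
<ᵇ-true m<n = Equivalence.to T-≡ (<⇒<ᵇ m<n)

<ᵇ-false : ∀ {m n} → n ≤ m → (m <ᵇ n) ≡ false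
<ᵇ-false {m} {n} n≤m with m <ᵇ n in eq
... | false = ≡.refl
... | true  = contradiction (<ᵇ⇒< m n (Equivalence.from T-≡ eq)) (≤⇒≯ n≤m)

relabel-< : ∀ {i v} → v < i → relabel i v ≡ suc v
relabel-< v<i rewrite <ᵇ-true v<i = ≡.refl

relabel-≥ : ∀ {i v} → i ≤ v → relabel i v ≡ suc (suc v)
relabel-≥ i≤v rewrite <ᵇ-false i≤v = ≡.refl

relabel-<ᵇ : ∀ i u v → (relabel i u <ᵇ relabel i v) ≡ (u <ᵇ v)
relabel-<ᵇ i u v with ≤-<-connex i u | ≤-<-connex i v
... | inj₂ u<i | inj₂ v<i rewrite relabel-< u<i | relabel-< v<i = ≡.refl
... | inj₂ u<i | inj₁ i≤v rewrite relabel-< u<i | relabel-≥ i≤v =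
  ≡.trans (<ᵇ-true (m<n⇒m<1+n (<-≤-trans u<i i≤v))) (≡.sym (<ᵇ-true (<-≤-trans u<i i≤v)))
... | inj₁ i≤u | inj₂ v<i rewrite relabel-≥ i≤u | relabel-< v<i =
  ≡.trans (<ᵇ-false (≤-trans (<⇒≤ v<i) (≤-trans i≤u (n≤1+n u)))) (≡.sym (<ᵇ-false (≤-trans (<⇒≤ v<i) i≤u)))
... | inj₁ i≤u | inj₁ i≤v rewrite relabel-≥ i≤u | relabel-≥ i≤v = ≡.refl

relabelEdge : ℕ → Edge → Edge
relabelEdge i e = relabel i (proj₁ e) , relabel i (proj₂ e)

crossesᵇ-relabel : ∀ i e f → crossesᵇ (relabelEdge i e) (relabelEdge i f) ≡ crossesᵇ e f
crossesᵇ-relabel i (a , b) (c , d)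
  rewrite relabel-<ᵇ i a c | relabel-<ᵇ i c b | relabel-<ᵇ i b d
        | relabel-<ᵇ i c a | relabel-<ᵇ i a d | relabel-<ᵇ i d b = ≡.refl

nestedᵇ-relabel : ∀ i e f → nestedᵇ (relabelEdge i e) (relabelEdge i f) ≡ nestedᵇ e f
nestedᵇ-relabel i (a , b) (c , d)
  rewrite relabel-<ᵇ i a c | relabel-<ᵇ i c d | relabel-<ᵇ i d b
        | relabel-<ᵇ i c a | relabel-<ᵇ i a b | relabel-<ᵇ i b d = ≡.refl

count-map : ∀ p (f : Edge → Edge) M → count p (map f M) ≡ count (p ∘ f) M
count-map p f []      = ≡.refl
count-map p f (e ∷ M) = ≡.cong ((if p (f e) then 1 else 0) +_) (count-map p f M)

count-cong : ∀ {P : Edge → Set} {p q : Edge → Bool} {M} → All P M → (∀ {e} → P e → p e ≡ q e) →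
             count p M ≡ count q M
count-cong             []         p≡q = ≡.refl
count-cong {M = e ∷ M} (Pe ∷ PM) p≡q = ≡.cong₂ (λ b n → (if b then 1 else 0) + n) (p≡q Pe) (count-cong PM p≡q)

count-cong-≗ : ∀ {p q : Edge → Bool} M → (∀ e → p e ≡ q e) → count p M ≡ count q M
count-cong-≗ M p≡q = count-cong (All.universal (λ _ → tt) M) (λ {e} _ → p≡q e)

pairCount-relabel : ∀ r i → (∀ e f → r (relabelEdge i e) (relabelEdge i f) ≡ r e f) →
                    ∀ M → pairCount r (map (relabelEdge i) M) ≡ pairCount r M
pairCount-relabel r i r-inv []      = ≡.refl
pairCount-relabel r i r-inv (e ∷ M) = ≡.cong₂ _+_
  (≡.trans (count-map (r (relabelEdge i e)) (relabelEdge i) M) (count-cong-≗ M (r-inv e)))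
  (pairCount-relabel r i r-inv M)

-- After inserting the edge {1, j+1}, an old edge crosses it iff it straddles gap j,
-- and is nested in it iff it lies before gap j.
straddles : ℕ → Edge → Bool
straddles j e = (proj₁ e <ᵇ j) ∧ not (proj₂ e <ᵇ j)

before : ℕ → Edge → Bool
before j e = (proj₁ e <ᵇ proj₂ e) ∧ (proj₂ e <ᵇ j)

2≤relabel : ∀ j v → 1 ≤ v → 2 ≤ relabel j v
2≤relabel j v 1≤v with ≤-<-connex j v
... | inj₁ j≤v rewrite relabel-≥ j≤v = s≤s (s≤s z≤n)
... | inj₂ v<j rewrite relabel-< v<j = s≤s 1≤v

relabel-<ᵇ-suc : ∀ {i j} → j ≤ i → ∀ v → (relabel i v <ᵇ suc j) ≡ (v <ᵇ j)
relabel-<ᵇ-suc {i} {j} j≤i v with ≤-<-connex i v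
... | inj₂ v<i rewrite relabel-< v<i = ≡.refl
... | inj₁ i≤v rewrite relabel-≥ i≤v =
  ≡.trans (<ᵇ-false (≤-trans j≤i (≤-trans i≤v (n≤1+n v)))) (≡.sym (<ᵇ-false (≤-trans j≤i i≤v)))

relabel-<ᵇ-2+ : ∀ {i j} → i ≤ j → ∀ v → (relabel i v <ᵇ suc (suc j)) ≡ (v <ᵇ j)
relabel-<ᵇ-2+ {i} {j} i≤j v with ≤-<-connex i v
... | inj₂ v<i rewrite relabel-< v<i =
  ≡.trans (<ᵇ-true (m<n⇒m<1+n (<-≤-trans v<i i≤j))) (≡.sym (<ᵇ-true (<-≤-trans v<i i≤j)))
... | inj₁ i≤v rewrite relabel-≥ i≤v = ≡.refl

suc-<ᵇ-relabel : ∀ j v → (suc j <ᵇ relabel j v) ≡ not (v <ᵇ j)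
suc-<ᵇ-relabel j v with ≤-<-connex j v
... | inj₂ v<j rewrite relabel-< v<j | <ᵇ-true v<j = <ᵇ-false (<⇒≤ v<j)
... | inj₁ j≤v rewrite relabel-≥ j≤v | <ᵇ-false j≤v = <ᵇ-true (s≤s j≤v)

crossesᵇ-new : ∀ j e → 1 ≤ proj₁ e → crossesᵇ (1 , suc j) (relabelEdge j e) ≡ straddles j e
crossesᵇ-new j (c , d) 1≤c
  rewrite <ᵇ-true {1} (2≤relabel j c 1≤c) | <ᵇ-false {relabel j c} {1} (≤-trans (s≤s z≤n) (2≤relabel j c 1≤c))
        | relabel-<ᵇ-suc (≤-refl {j}) c | suc-<ᵇ-relabel j d = ∨-identityʳ _

nestedᵇ-new : ∀ j e → 1 ≤ proj₁ e → nestedᵇ (1 , suc j) (relabelEdge j e) ≡ before j e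
nestedᵇ-new j (c , d) 1≤c
  rewrite <ᵇ-true {1} (2≤relabel j c 1≤c) | <ᵇ-false {relabel j c} {1} (≤-trans (s≤s z≤n) (2≤relabel j c 1≤c))
        | relabel-<ᵇ j c d | relabel-<ᵇ-suc (≤-refl {j}) d = ∨-identityʳ _

Positive : Matching → Set
Positive = All (λ e → 1 ≤ proj₁ e)

cr-insertFirst : ∀ j M → Positive M → cr (insertFirst M j) ≡ count (straddles j) M + cr M
cr-insertFirst j M pos = ≡.cong₂ _+_
  (≡.trans (count-map (crossesᵇ (1 , suc j)) (relabelEdge j) M) (count-cong pos (crossesᵇ-new j _)))
  (pairCount-relabel crossesᵇ j (crossesᵇ-relabel j) M)

ne-insertFirst : ∀ j M → Positive M → ne (insertFirst M j) ≡ count (before j) M + ne M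
ne-insertFirst j M pos = ≡.cong₂ _+_
  (≡.trans (count-map (nestedᵇ (1 , suc j)) (relabelEdge j) M) (count-cong pos (nestedᵇ-new j _)))
  (pairCount-relabel nestedᵇ j (nestedᵇ-relabel j) M)

straddles-insertFirst-≤ : ∀ {i j} → 1 ≤ j → j ≤ i → ∀ M →
                          count (straddles (suc j)) (insertFirst M i) ≡ suc (count (straddles j) M)
straddles-insertFirst-≤ {i} {suc j} _ j≤i M rewrite <ᵇ-false {i} {suc j} j≤i = ≡.cong suc
  (≡.trans (count-map (straddles (suc (suc j))) (relabelEdge i) M)
           (count-cong-≗ M (λ e → ≡.cong₂ (λ b b′ → b ∧ not b′) (relabel-<ᵇ-suc j≤i (proj₁ e)) (relabel-<ᵇ-suc j≤i (proj₂ e)))))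

before-insertFirst-≤ : ∀ {i j} → 1 ≤ i → j ≤ i → ∀ M → count (before (suc j)) (insertFirst M i) ≡ count (before j) M
before-insertFirst-≤ {suc i} {j} _ j≤i M rewrite <ᵇ-false {suc i} {j} j≤i =
  ≡.trans (count-map (before (suc j)) (relabelEdge (suc i)) M)
          (count-cong-≗ M (λ e → ≡.cong₂ _∧_ (relabel-<ᵇ (suc i) (proj₁ e) (proj₂ e)) (relabel-<ᵇ-suc j≤i (proj₂ e))))

straddles-insertFirst-≥ : ∀ {i k} → i ≤ k → ∀ M → count (straddles (2 + k)) (insertFirst M i) ≡ count (straddles k) M
straddles-insertFirst-≥ {i} {k} i≤k M rewrite <ᵇ-true {i} {suc k} (s≤s i≤k) =
  ≡.trans (count-map (straddles (2 + k)) (relabelEdge i) M)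
          (count-cong-≗ M (λ e → ≡.cong₂ (λ b b′ → b ∧ not b′) (relabel-<ᵇ-2+ i≤k (proj₁ e)) (relabel-<ᵇ-2+ i≤k (proj₂ e))))

before-insertFirst-≥ : ∀ {i k} → 1 ≤ i → i ≤ k → ∀ M →
                       count (before (2 + k)) (insertFirst M i) ≡ suc (count (before k) M)
before-insertFirst-≥ {suc i} {k} _ i≤k M rewrite <ᵇ-true {suc i} {suc k} (s≤s i≤k) = ≡.cong suc
  (≡.trans (count-map (before (2 + k)) (relabelEdge (suc i)) M)
           (count-cong-≗ M (λ e → ≡.cong₂ _∧_ (relabel-<ᵇ (suc i) (proj₁ e) (proj₂ e)) (relabel-<ᵇ-2+ i≤k (proj₂ e)))))

straddles-1 : ∀ {M} → Positive M → count (straddles 1) M ≡ 0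
straddles-1 []                         = ≡.refl
straddles-1 {(suc c , d) ∷ M} (_ ∷ pos) = straddles-1 pos

before-1 : ∀ M → count (before 1) M ≡ 0
before-1 []                = ≡.refl
before-1 ((c , zero) ∷ M)  = before-1 M
before-1 ((c , suc d) ∷ M) rewrite ∧-zeroʳ (c <ᵇ suc d) = before-1 M

insertFirst-positive : ∀ M i → Positive (insertFirst M i)
insertFirst-positive M i = s≤s z≤n ∷ AllP.map⁺ (All.universal (λ e → 1≤relabel (proj₁ e)) M)
  where
  1≤relabel : ∀ v → 1 ≤ relabel i v
  1≤relabel v with v <ᵇ i
  ... | true  = s≤s z≤n
  ... | false = s≤s z≤n

data Grown : Matching → Set where
  empty : Grown []
  grow  : ∀ {M i} → Grown M → 1 ≤ i → i ≤ suc (2 * length M) → Grown (insertFirst M i)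

Grown⇒Positive : ∀ {M} → Grown M → Positive M
Grown⇒Positive empty                  = []
Grown⇒Positive (grow {M} {i} _ _ _) = insertFirst-positive M i

unrelabel-relabel : ∀ i v → unrelabel (suc i) (relabel i v) ≡ v
unrelabel-relabel i v with ≤-<-connex i v
... | inj₂ v<i rewrite relabel-< v<i | <ᵇ-true v<i = ≡.refl
... | inj₁ i≤v rewrite relabel-≥ i≤v | <ᵇ-false {suc v} {i} (≤-trans i≤v (n≤1+n v)) = ≡.refl

unrelabel-relabelEdges : ∀ i M → map (λ e → unrelabel (suc i) (proj₁ e) , unrelabel (suc i) (proj₂ e))
                                     (map (relabelEdge i) M) ≡ M
unrelabel-relabelEdges i []      = ≡.refl
unrelabel-relabelEdges i (e ∷ M) =
  ≡.cong₂ _∷_ (≡.cong₂ _,_ (unrelabel-relabel i (proj₁ e)) (unrelabel-relabel i (proj₂ e))) (unrelabel-relabelEdges i M)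

-- Every matching arises by insertions

interval : ℕ → ℕ → List ℕ
interval m zero    = []
interval m (suc k) = m ∷ interval (suc m) k

length-interval : ∀ m k → length (interval m k) ≡ k
length-interval m zero    = ≡.refl
length-interval m (suc k) = ≡.cong suc (length-interval (suc m) k)

applyUpTo-interval : ∀ (f : ℕ → ℕ) m k → (∀ x → f x ≡ x + m) → applyUpTo f k ≡ interval m k
applyUpTo-interval f m zero    f≗+m = ≡.refl
applyUpTo-interval f m (suc k) f≗+m = ≡.cong₂ _∷_ (f≗+m 0)
  (applyUpTo-interval (f ∘ suc) (suc m) k (λ x → ≡.trans (f≗+m (suc x)) (≡.sym (+-suc x m))))

points-interval : ∀ n → points n ≡ interval 1 (2 * n)
points-interval n = ≡.trans (map-upTo suc (2 * n)) (applyUpTo-interval suc 1 (2 * n) (λ x → +-comm 1 x))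

∈-interval : ∀ {x} m k → x ∈ interval m k → m ≤ x × x < m + k
∈-interval m (suc k) (here ≡.refl) = ≤-refl , ≡.subst (m <_) (≡.sym (+-suc m k)) (s≤s (m≤m+n m k))
∈-interval {x} m (suc k) (there x∈) with ∈-interval (suc m) k x∈
... | m<x , x<m+k = <⇒≤ m<x , ≡.subst (x <_) (≡.sym (+-suc m k)) x<m+k

interval-++ : ∀ m k k′ → interval m k ++ interval (m + k) k′ ≡ interval m (k + k′)
interval-++ m zero    k′ = ≡.cong (λ z → interval z k′) (+-identityʳ m)
interval-++ m (suc k) k′ = ≡.cong (m ∷_) (≡.trans (≡.cong (λ z → interval (suc m) k ++ interval z k′) (+-suc m k))
                                                   (interval-++ (suc m) k k′))

interval-split : ∀ k m x → m ≤ x → x < m + k → interval m k ≡ interval m (x ∸ m) ++ x ∷ interval (suc x) (m + k ∸ suc x)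
interval-split zero    m x m≤x x<m+0 = contradiction (≡.subst (x <_) (+-identityʳ m) x<m+0) (≤⇒≯ m≤x)
interval-split (suc k) m x m≤x x<m+k with m≤n⇒m<n∨m≡n m≤x
... | inj₂ ≡.refl rewrite n∸n≡0 m | +-suc m k | m+n∸m≡n m k = ≡.refl
... | inj₁ m<x    rewrite +-suc m k | +-∸-assoc 1 m<x = ≡.cong (m ∷_) (interval-split k (suc m) x m<x x<m+k)

map-unrelabel-below : ∀ b m k → suc m + k ≤ b → map (unrelabel b) (interval (suc m) k) ≡ interval m k
map-unrelabel-below b m zero    _ = ≡.refl
map-unrelabel-below b m (suc k) m+k<b rewrite +-suc (suc m) k | <ᵇ-true {suc m} {b} (≤-trans (s≤s (s≤s (m≤m+n m k))) m+k<b) =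
  ≡.cong (m ∷_) (map-unrelabel-below b (suc m) k m+k<b)

map-unrelabel-above : ∀ b m k → b < 2 + m → map (unrelabel b) (interval (2 + m) k) ≡ interval m k
map-unrelabel-above b m zero    _   = ≡.refl
map-unrelabel-above b m (suc k) b<m rewrite <ᵇ-false {2 + m} {b} (<⇒≤ b<m) =
  ≡.cong (m ∷_) (map-unrelabel-above b (suc m) k (≤-trans b<m (n≤1+n _)))

vertices-map : ∀ (f : ℕ → ℕ) M → vertices (map (λ e → f (proj₁ e) , f (proj₂ e)) M) ≡ map f (vertices M)
vertices-map f []      = ≡.refl
vertices-map f (e ∷ M) = ≡.cong (λ vs → f (proj₁ e) ∷ f (proj₂ e) ∷ vs) (vertices-map f M)

length-vertices : ∀ M → length (vertices M) ≡ 2 * length M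
length-vertices []      = ≡.refl
length-vertices (e ∷ M) = ≡.trans (≡.cong (suc ∘ suc) (length-vertices M)) (≡.sym (*-suc 2 (length M)))

All-vertices : ∀ {P : ℕ → Set} M → All P (vertices M) → All (λ e → P (proj₁ e) × P (proj₂ e)) M
All-vertices []      _               = []
All-vertices (e ∷ M) (Pu ∷ Pv ∷ PM) = (Pu , Pv) ∷ All-vertices M PM

Increasing : Matching → Set
Increasing = All (λ e → proj₁ e < proj₂ e)

FirstsIncreasing : Matching → Set
FirstsIncreasing = Linked (λ e f → proj₁ e < proj₁ f)

vertices-above : ∀ {a} M → All (λ f → a < proj₁ f) M → Increasing M → All (a <_) (vertices M)
vertices-above []      _           _           = []
vertices-above (f ∷ M) (a<f ∷ a<M) (f<f ∷ inc) = a<f ∷ <-trans a<f f<f ∷ vertices-above M a<M inc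

-- The first edge {1, B} of a matching is removed by unrelabel B; on every other
-- vertex (which lies in [2, B) ∪ (B, ∞)) relabel (B - 1) inverts it.
module WithoutFirstEdge (b : ℕ) where
  B : ℕ
  B = 2 + b

  Away : ℕ → Set
  Away v = 2 ≤ v × v ≢ B

  unrelabelEdge : Edge → Edge
  unrelabelEdge e = unrelabel B (proj₁ e) , unrelabel B (proj₂ e)

  unrelabel-cases : ∀ v → Away v → (v < B × unrelabel B v ≡ v ∸ 1) ⊎ (B < v × unrelabel B v ≡ v ∸ 2)
  unrelabel-cases v (_ , v≢B) with ≤-<-connex B v
  ... | inj₂ v<B rewrite <ᵇ-true v<B = inj₁ (v<B , ≡.refl)
  ... | inj₁ B≤v with m≤n⇒m<n∨m≡n B≤v
  ...   | inj₁ B<v rewrite <ᵇ-false B≤v = inj₂ (B<v , ≡.refl)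
  ...   | inj₂ B≡v = contradiction (≡.sym B≡v) v≢B

  relabel-unrelabel : ∀ v → Away v → relabel (suc b) (unrelabel B v) ≡ v
  relabel-unrelabel (suc zero)    (s≤s () , _)
  relabel-unrelabel (suc (suc v)) away with unrelabel-cases (suc (suc v)) away
  ... | inj₁ (v<B , eq) rewrite eq | <ᵇ-true {v} {b} (≤-pred (≤-pred v<B)) = ≡.refl
  ... | inj₂ (B<v , eq) rewrite eq | <ᵇ-false {v} {suc b} (≤-pred (≤-pred B<v)) = ≡.refl

  unrelabel-< : ∀ u v → Away u → Away v → u < v → unrelabel B u < unrelabel B v
  unrelabel-< (suc zero) _ (s≤s () , _) _ _
  unrelabel-< _ (suc zero) _ (s≤s () , _) _
  unrelabel-< (suc (suc u)) (suc (suc v)) away-u away-v u<v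
    with unrelabel-cases (suc (suc u)) away-u | unrelabel-cases (suc (suc v)) away-v
  ... | inj₁ (_ , eq) | inj₁ (_ , eq′) rewrite eq | eq′ = ≤-pred u<v
  ... | inj₁ (u<B , eq) | inj₂ (B<v , eq′) rewrite eq | eq′ = ≤-trans (≤-pred u<B) (≤-pred (≤-pred B<v))
  ... | inj₂ (B<u , _) | inj₁ (v<B , _) = contradiction (<-trans B<u (<-trans u<v v<B)) (<-irrefl ≡.refl)
  ... | inj₂ (_ , eq) | inj₂ (_ , eq′) rewrite eq | eq′ = ≤-pred (≤-pred u<v)

  AwayEdge : Edge → Set
  AwayEdge e = Away (proj₁ e) × Away (proj₂ e)

  Away-vertices : ∀ n {vs} → vs ↭ₚ interval 2 b ++ interval (suc B) (2 * n ∸ b) → All Away vs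
  Away-vertices n vs↭ = All.tabulate (λ v∈vs → away (∈-++⁻ (interval 2 b) (∈-resp-↭ₚ vs↭ v∈vs)))
    where
    away : ∀ {v} → v ∈ interval 2 b ⊎ v ∈ interval (suc B) (2 * n ∸ b) → Away v
    away (inj₁ v∈) with ∈-interval 2 b v∈
    ... | 2≤v , v<B = 2≤v , λ v≡B → <-irrefl v≡B v<B
    away (inj₂ v∈) with ∈-interval (suc B) (2 * n ∸ b) v∈
    ... | B<v , _ = ≤-trans (s≤s (s≤s z≤n)) (<⇒≤ B<v) , λ v≡B → <-irrefl (≡.sym v≡B) B<v

  unrelabel-Increasing : ∀ {M} → All AwayEdge M → Increasing M → Increasing (map unrelabelEdge M)
  unrelabel-Increasing []                   []          = []
  unrelabel-Increasing ((au , av) ∷ aways) (u<v ∷ inc) = unrelabel-< _ _ au av u<v ∷ unrelabel-Increasing aways inc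

  unrelabel-FirstsIncreasing : ∀ {M} → All AwayEdge M → FirstsIncreasing M → FirstsIncreasing (map unrelabelEdge M)
  unrelabel-FirstsIncreasing []                  []           = []
  unrelabel-FirstsIncreasing (_ ∷ [])            [-]          = [-]
  unrelabel-FirstsIncreasing (ae ∷ af ∷ aways) (e<f ∷ lnk) =
    unrelabel-< _ _ (proj₁ ae) (proj₁ af) e<f ∷ unrelabel-FirstsIncreasing (af ∷ aways) lnk

  relabel-unrelabelEdges : ∀ {M} → All AwayEdge M → map (relabelEdge (suc b)) (map unrelabelEdge M) ≡ M
  relabel-unrelabelEdges []                       = ≡.refl
  relabel-unrelabelEdges {e ∷ M} ((au , av) ∷ aways) =
    ≡.cong₂ _∷_ (≡.cong₂ _,_ (relabel-unrelabel (proj₁ e) au) (relabel-unrelabel (proj₂ e) av)) (relabel-unrelabelEdges aways)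

  grown : ∀ n M → (∀ M′ → IsMatching n M′ → Grown M′) → Increasing M → FirstsIncreasing M →
          B ∷ vertices M ↭ₚ interval 2 (suc (2 * n)) → B < 2 + suc (2 * n) → length M ≡ n → Grown ((1 , B) ∷ M)
  grown n M grown-n inc lnk vs↭ B<bound |M|≡n =
    ≡.subst Grown (≡.cong ((1 , B) ∷_) (relabel-unrelabelEdges aways))
            (grow (grown-n M′ (unrelabel-Increasing aways inc , unrelabel-FirstsIncreasing aways lnk , vertices-M′))
                  (s≤s z≤n) (s≤s (≡.subst (λ m → b ≤ 2 * m) (≡.sym |M′|≡n) b≤2n)))
    where
    b≤2n : b ≤ 2 * n
    b≤2n = ≤-pred (≤-pred (≤-pred B<bound))
    others : vertices M ↭ₚ interval 2 b ++ interval (suc B) (2 * n ∸ b)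
    others = drop-mid [] (interval 2 b)
      (↭ₚ-trans vs↭ (↭ₚ-reflexive (interval-split (suc (2 * n)) 2 B (s≤s (s≤s z≤n)) B<bound)))
    aways : All AwayEdge M
    aways = All-vertices M (Away-vertices n others)
    M′ : Matching
    M′ = map unrelabelEdge M
    |M′|≡n : length M′ ≡ n
    |M′|≡n = ≡.trans (length-map unrelabelEdge M) |M|≡n
    vertices-M′ : vertices M′ ↭ₚ points n
    vertices-M′ = begin
      vertices M′
        ≡⟨ vertices-map (unrelabel B) M ⟩
      map (unrelabel B) (vertices M)
        ↭⟨ ↭ₚ-map⁺ (unrelabel B) others ⟩
      map (unrelabel B) (interval 2 b ++ interval (suc B) (2 * n ∸ b))
        ≡⟨ map-++ (unrelabel B) (interval 2 b) _ ⟩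
      map (unrelabel B) (interval 2 b) ++ map (unrelabel B) (interval (suc B) (2 * n ∸ b))
        ≡⟨ ≡.cong₂ _++_ (map-unrelabel-below B 1 b ≤-refl) (map-unrelabel-above B (suc b) (2 * n ∸ b) ≤-refl) ⟩
      interval 1 b ++ interval (suc b) (2 * n ∸ b)
        ≡⟨ interval-++ 1 b (2 * n ∸ b) ⟩
      interval 1 (b + (2 * n ∸ b))
        ≡⟨ ≡.cong (interval 1) (m+[n∸m]≡n b≤2n) ⟩
      interval 1 (2 * n)
        ≡⟨ points-interval n ⟨
      points n ∎
      where open PermutationReasoningₚ

grown-firstEdge : ∀ n a b M → a ≡ 1 → 2 ≤ b → b < 2 + suc (2 * n) → a ∷ b ∷ vertices M ↭ₚ 1 ∷ interval 2 (suc (2 * n)) →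
                  Increasing M → FirstsIncreasing M → length M ≡ n → (∀ M′ → IsMatching n M′ → Grown M′) → Grown ((a , b) ∷ M)
grown-firstEdge n .1 (suc (suc b)) M ≡.refl (s≤s (s≤s _)) b<bound vs↭ inc lnk |M|≡n grown-n =
  WithoutFirstEdge.grown b n M grown-n inc lnk (drop-∷ vs↭) b<bound |M|≡n

IsMatching⇒Grown : ∀ n M → IsMatching n M → Grown M
IsMatching⇒Grown n       []            _             = empty
IsMatching⇒Grown zero    (e ∷ M)       (_ , _ , vs↭) with ↭-length vs↭
... | ()
IsMatching⇒Grown (suc n) ((a , b) ∷ M) (a<b ∷ inc , lnk , vs↭) =
  grown-firstEdge n a b M a≡1 (proj₁ b-bounds) (proj₂ b-bounds) vs↭′ inc (tail lnk) |M|≡n (IsMatching⇒Grown n)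
  where
  tail : ∀ {e M} → FirstsIncreasing (e ∷ M) → FirstsIncreasing M
  tail [-]       = []
  tail (_ ∷ lnk) = lnk
  vs↭′ : a ∷ b ∷ vertices M ↭ₚ 1 ∷ interval 2 (suc (2 * n))
  vs↭′ = ↭ₚ-trans vs↭ (↭ₚ-reflexive (≡.trans (points-interval (suc n)) (≡.cong (interval 1) (*-suc 2 n))))
  1≤a : 1 ≤ a
  1≤a = proj₁ (∈-interval 1 (suc (suc (2 * n))) (∈-resp-↭ₚ vs↭′ (here ≡.refl)))
  a<M : All (a <_) (vertices M)
  a<M = vertices-above M (firsts lnk) inc
    where
    firsts : ∀ {M} → FirstsIncreasing ((a , b) ∷ M) → All (λ f → a < proj₁ f) M
    firsts [-]         = []
    firsts (a<f ∷ lnk) = Linked⇒All {R = λ e f → proj₁ e < proj₁ f} (λ {e f g} → <-trans) {v = a , b} a<f lnk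
  a≡1 : a ≡ 1
  a≡1 with ∈-resp-↭ₚ (↭ₚ-sym vs↭′) (here ≡.refl)
  ... | here 1≡a          = ≡.sym 1≡a
  ... | there (here 1≡b)  = contradiction (≡.subst (a <_) (≡.sym 1≡b) a<b) (≤⇒≯ 1≤a)
  ... | there (there 1∈M) = contradiction (All.lookup a<M 1∈M) (≤⇒≯ 1≤a)
  b-bounds : 2 ≤ b × b < 2 + suc (2 * n)
  b-bounds with ∈-resp-↭ₚ vs↭′ (there (here ≡.refl))
  ... | here b≡1 = contradiction (≡.subst (a <_) b≡1 a<b) (≤⇒≯ 1≤a)
  ... | there b∈ = ∈-interval 2 (suc (2 * n)) b∈
  |M|≡n : length M ≡ n
  |M|≡n = suc-injective (*-cancelˡ-≡ (suc (length M)) (suc n) 2 (begin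
    2 * suc (length M)              ≡⟨ length-vertices ((a , b) ∷ M) ⟨
    length (vertices ((a , b) ∷ M)) ≡⟨ ↭-length vs↭ ⟩
    length (points (suc n))         ≡⟨ ≡.cong length (points-interval (suc n)) ⟩
    length (interval 1 (2 * suc n)) ≡⟨ length-interval 1 (2 * suc n) ⟩
    2 * suc n                       ∎))
    where open ≡.≡-Reasoning

-- The statistic on the insertion tree

T-suc : ∀ M l → T M (suc l) ≡ concatMap (λ N → T N l) (children M)
T-suc M zero    = ≡.trans (++-identityʳ (children M)) (≡.sym (concatMap-pure (children M)))
T-suc M (suc l) = ≡.trans (≡.cong (concatMap children) (T-suc M l)) (concatMap-concatMap children (λ N → T N l) (children M))

module Statistics {c ℓ} (G : AbelianGroup c ℓ) where
  open AbelianGroup G renaming (Carrier to C; refl to ≈-refl; sym to ≈-sym; trans to ≈-trans)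
  open WithGroup G
  open Multisets G
  open import Algebra.Properties.CommutativeSemigroup commutativeSemigroup using (interchange; x∙yz≈y∙xz)
  open import Data.List.Relation.Binary.Equality.Setoid setoid
    using (_≋_; ≋-trans; ≋-reflexive; ≋-setoid; ≋-length) renaming (++⁺ to ++⁺-≋)
  open import Data.List.Relation.Binary.Pointwise using ([]; _∷_)
  open import Data.List.Relation.Binary.Permutation.Setoid setoid
    using (_↭_; ↭-refl; ↭-sym; ↭-trans; ↭-reflexive-≋; prep; module PermutationReasoning)
  open import Data.List.Relation.Binary.Permutation.Setoid.Properties setoid using (∈-resp-↭)
  open BagProperties setoid

  times-+ : ∀ m n x → times (m + n) x ≈ times m x ∙ times n x
  times-+ zero    n x = ≈-sym (identityˡ _)
  times-+ (suc m) n x = ≈-trans (∙-congˡ (times-+ m n x)) (≈-sym (assoc x _ _))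

  nth-++ˡ : ∀ j xs ys → suc j ≤ length xs → nth (suc j) (xs ++ ys) ≡ nth (suc j) xs
  nth-++ˡ zero    (x ∷ xs) ys _         = ≡.refl
  nth-++ˡ (suc j) (x ∷ xs) ys (s≤s j<n) = nth-++ˡ j xs ys j<n

  nth-++ʳ : ∀ xs ys m → nth (length xs + suc m) (xs ++ ys) ≡ nth (suc m) ys
  nth-++ʳ []       ys m = ≡.refl
  nth-++ʳ (x ∷ xs) ys m rewrite +-suc (length xs) m =
    ≡.subst (λ k → nth k (xs ++ ys) ≡ nth (suc m) ys) (+-suc (length xs) m) (nth-++ʳ xs ys m)

  nth-shift : ∀ j y xs → suc j ≤ length xs → nth (suc j) (shift y xs) ≡ nth (suc j) xs ∙ y
  nth-shift zero    y (x ∷ xs) _         = ≡.refl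
  nth-shift (suc j) y (x ∷ xs) (s≤s j<n) = nth-shift j y xs j<n

  nth-take : ∀ j i xs → suc j ≤ i → nth (suc j) (take i xs) ≡ nth (suc j) xs
  nth-take j       (suc i) []       _         = ≡.refl
  nth-take zero    (suc i) (x ∷ xs) _         = ≡.refl
  nth-take (suc j) (suc i) (x ∷ xs) (s≤s j<i) = nth-take j i xs j<i

  nth-drop : ∀ n m xs → nth (suc m) (drop n xs) ≡ nth (n + suc m) xs
  nth-drop zero    m xs       = ≡.refl
  nth-drop (suc n) m []       = ≡.refl
  nth-drop (suc n) m (x ∷ xs) rewrite +-suc n m =
    ≡.subst (λ k → nth (suc m) (drop n xs) ≡ nth k xs) (+-suc n m) (nth-drop n m xs)

  length-take-≤ : ∀ i (xs : List C) → i ≤ length xs → length (take i xs) ≡ i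
  length-take-≤ i xs i≤n = ≡.trans (length-take i xs) (m≤n⇒m⊓n≡m i≤n)

  length-R : ∀ a b i xs → 1 ≤ i → i ≤ length xs → length (R a b i xs) ≡ 2 + length xs
  length-R a b (suc i) xs _ i<n = ≡.cong suc (begin
    length (shift _ (take (suc i) xs) ++ shift _ (drop i xs))
      ≡⟨ length-++ (shift _ (take (suc i) xs)) ⟩
    length (shift _ (take (suc i) xs)) + length (shift _ (drop i xs))
      ≡⟨ ≡.cong₂ _+_ (≡.trans (length-map _ (take (suc i) xs)) (length-take-≤ (suc i) xs i<n))
                     (≡.trans (length-map _ (drop i xs)) (length-drop i xs)) ⟩
    suc i + (length xs ∸ i)
      ≡⟨ ≡.cong suc (m+[n∸m]≡n (<⇒≤ i<n)) ⟩
    suc (length xs) ∎)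
    where open ≡.≡-Reasoning

  nth-R-< : ∀ a b i xs j → suc j ≤ i → i ≤ length xs →
            nth (2 + j) (R a b i xs) ≡ nth (suc j) xs ∙ ((nth i xs ∙ nth 1 xs ⁻¹) ∙ a)
  nth-R-< a b i xs j j<i i≤n = begin
    nth (suc j) (shift y (take i xs) ++ _) ≡⟨ nth-++ˡ j (shift y (take i xs)) _ (≡.subst (suc j ≤_) (≡.sym |front|) j<i) ⟩
    nth (suc j) (shift y (take i xs))      ≡⟨ nth-shift j y (take i xs) (≡.subst (suc j ≤_) (≡.sym (length-take-≤ i xs i≤n)) j<i) ⟩
    nth (suc j) (take i xs) ∙ y            ≡⟨ ≡.cong (_∙ y) (nth-take j i xs j<i) ⟩
    nth (suc j) xs ∙ y                     ∎
    where
    open ≡.≡-Reasoning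
    y : C
    y = (nth i xs ∙ nth 1 xs ⁻¹) ∙ a
    |front| : length (shift y (take i xs)) ≡ i
    |front| = ≡.trans (length-map _ (take i xs)) (length-take-≤ i xs i≤n)

  nth-R-≥ : ∀ a b i xs k → 1 ≤ i → i + k ≤ length xs →
            nth (2 + (i + k)) (R a b i xs) ≡ nth (i + k) xs ∙ ((nth i xs ∙ nth 1 xs ⁻¹) ∙ b)
  nth-R-≥ a b (suc i) xs k _ i+k≤n = begin
    nth (suc (suc i + k)) (shift y (take (suc i) xs) ++ shift z (drop i xs))
      ≡⟨ ≡.cong (λ m → nth m (shift y (take (suc i) xs) ++ shift z (drop i xs))) index ⟩
    nth (length (shift y (take (suc i) xs)) + suc k) (shift y (take (suc i) xs) ++ shift z (drop i xs))
      ≡⟨ nth-++ʳ (shift y (take (suc i) xs)) (shift z (drop i xs)) k ⟩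
    nth (suc k) (shift z (drop i xs))
      ≡⟨ nth-shift k z (drop i xs) k<|back| ⟩
    nth (suc k) (drop i xs) ∙ z
      ≡⟨ ≡.cong (_∙ z) (≡.trans (nth-drop i k xs) (≡.cong (λ m → nth m xs) (+-suc i k))) ⟩
    nth (suc i + k) xs ∙ z ∎
    where
    open ≡.≡-Reasoning
    y : C
    y = (nth (suc i) xs ∙ nth 1 xs ⁻¹) ∙ a
    z : C
    z = (nth (suc i) xs ∙ nth 1 xs ⁻¹) ∙ b
    k<|back| : suc k ≤ length (drop i xs)
    k<|back| = ≡.subst (suc k ≤_) (≡.sym (length-drop i xs))
                       (m+n≤o⇒m≤o∸n (suc k) (≡.subst (_≤ length xs) (≡.cong suc (+-comm i k)) i+k≤n))
    index : suc (suc i + k) ≡ length (shift y (take (suc i) xs)) + suc k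
    index = ≡.trans (≡.sym (+-suc (suc i) k))
      (≡.cong (_+ suc k) (≡.sym (≡.trans (length-map _ (take (suc i) xs)) (length-take-≤ (suc i) xs (m+n≤o⇒m≤o (suc i) i+k≤n)))))

  take⁺ : ∀ i {xs ys} → xs ≋ ys → take i xs ≋ take i ys
  take⁺ zero    _           = []
  take⁺ (suc i) []          = []
  take⁺ (suc i) (x≈y ∷ eqs) = x≈y ∷ take⁺ i eqs

  drop⁺ : ∀ i {xs ys} → xs ≋ ys → drop i xs ≋ drop i ys
  drop⁺ zero    eqs         = eqs
  drop⁺ (suc i) []          = []
  drop⁺ (suc i) (_ ∷ eqs)   = drop⁺ i eqs

  nth-cong : ∀ i {xs ys} → xs ≋ ys → nth i xs ≈ nth i ys
  nth-cong i             []          = ≈-refl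
  nth-cong zero          (_ ∷ _)     = ≈-refl
  nth-cong (suc zero)    (x≈y ∷ _)   = x≈y
  nth-cong (suc (suc i)) (_ ∷ eqs)   = nth-cong (suc i) eqs

  shift-shift⁻¹ : ∀ h xs → xs ≋ shift h (shift (h ⁻¹) xs)
  shift-shift⁻¹ h []       = []
  shift-shift⁻¹ h (x ∷ xs) =
    ≈-sym (≈-trans (assoc x (h ⁻¹) h) (≈-trans (∙-congˡ (inverseˡ h)) (identityʳ x))) ∷ shift-shift⁻¹ h xs

  shift-· : ∀ {x y h} zs → x ≈ y ∙ h → shift x zs ≋ shift h (y · zs)
  shift-· []       _     = []
  shift-· (z ∷ zs) x≈yh = ≈-trans (∙-congˡ x≈yh) (≈-trans (≈-sym (assoc z _ _)) (∙-congʳ (comm z _))) ∷ shift-· zs x≈yh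

  shift-rebase : ∀ {h x c} a {xs} zs → xs ≋ shift h zs → c ≈ (x ∙ h ⁻¹) ∙ a → shift c xs ≋ shift x (a · zs)
  shift-rebase a []       []              _ = []
  shift-rebase {h} {x} a (z ∷ zs) (x≈ ∷ xs≋) c≈ = ≈-trans (∙-cong x≈ c≈) (begin
    (z ∙ h) ∙ ((x ∙ h ⁻¹) ∙ a)   ≈⟨ ∙-congˡ (≈-trans (∙-congʳ (comm x (h ⁻¹))) (assoc (h ⁻¹) x a)) ⟩
    (z ∙ h) ∙ (h ⁻¹ ∙ (x ∙ a))   ≈⟨ assoc z h _ ⟩
    z ∙ (h ∙ (h ⁻¹ ∙ (x ∙ a)))   ≈⟨ ∙-congˡ (≈-trans (≈-sym (assoc h (h ⁻¹) _)) (≈-trans (∙-congʳ (inverseʳ h)) (identityˡ _))) ⟩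
    z ∙ (x ∙ a)                  ≈⟨ ∙-congˡ (comm x a) ⟩
    z ∙ (a ∙ x)                  ≈⟨ assoc z a x ⟨
    (z ∙ a) ∙ x                  ≈⟨ ∙-congʳ (comm z a) ⟩
    (a ∙ z) ∙ x                  ∎) ∷ shift-rebase a zs xs≋ c≈
    where open import Relation.Binary.Reasoning.Setoid setoid

  rebase : ∀ {h u v xᵢ x₁} a → xᵢ ≈ h ∙ u → x₁ ≈ h → (h ∙ v) ∙ ((xᵢ ∙ x₁ ⁻¹) ∙ a) ≈ (h ∙ u) ∙ (a ∙ v)
  rebase {h} {u} {v} {xᵢ} {x₁} a xᵢ≈ x₁≈ = begin
    (h ∙ v) ∙ ((xᵢ ∙ x₁ ⁻¹) ∙ a)  ≈⟨ ∙-congˡ (∙-congʳ xᵢ-x₁≈u) ⟩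
    (h ∙ v) ∙ (u ∙ a)             ≈⟨ interchange h v u a ⟩
    (h ∙ u) ∙ (v ∙ a)             ≈⟨ ∙-congˡ (comm v a) ⟩
    (h ∙ u) ∙ (a ∙ v)             ∎
    where
    open import Relation.Binary.Reasoning.Setoid setoid
    xᵢ-x₁≈u : xᵢ ∙ x₁ ⁻¹ ≈ u
    xᵢ-x₁≈u = begin
      xᵢ ∙ x₁ ⁻¹        ≈⟨ ∙-cong (≈-trans xᵢ≈ (comm h u)) (⁻¹-cong x₁≈) ⟩
      (u ∙ h) ∙ h ⁻¹    ≈⟨ assoc u h (h ⁻¹) ⟩
      u ∙ (h ∙ h ⁻¹)    ≈⟨ ∙-congˡ (inverseʳ h) ⟩
      u ∙ ε             ≈⟨ identityʳ u ⟩
      u                 ∎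

  module _ (α β : C) where
    gapWeight : Matching → ℕ → C
    gapWeight M j = times (count (straddles j) M) α ∙ times (count (before j) M) β

    s-insertFirst : ∀ M j → Positive M → s α β (insertFirst M j) ≈ s α β M ∙ gapWeight M j
    s-insertFirst M j pos rewrite cr-insertFirst j M pos | ne-insertFirst j M pos =
      ≈-trans (∙-cong (times-+ (count (straddles j) M) (cr M) α) (times-+ (count (before j) M) (ne M) β))
              (≈-trans (interchange _ _ _ _) (comm _ _))

    gapWeight-1 : ∀ {M} → Positive M → gapWeight M 1 ≈ ε
    gapWeight-1 {M} pos rewrite straddles-1 pos | before-1 M = identityˡ ε

    seq-insertFirst : ∀ M i → seq α β (insertFirst M i) ≡ R α β i (seq α β M)
    seq-insertFirst M i rewrite unrelabel-relabelEdges i M | length-map (relabelEdge i) M = ≡.refl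

    length-seq : ∀ {M} → Grown M → length (seq α β M) ≡ suc (2 * length M)
    length-seq empty = ≡.refl
    length-seq (grow {M} {i} g 1≤i i≤) = begin
      length (seq α β (insertFirst M i))  ≡⟨ ≡.cong length (seq-insertFirst M i) ⟩
      length (R α β i (seq α β M))        ≡⟨ length-R α β i (seq α β M) 1≤i (≡.subst (i ≤_) (≡.sym (length-seq g)) i≤) ⟩
      2 + length (seq α β M)              ≡⟨ ≡.cong (2 +_) (length-seq g) ⟩
      2 + suc (2 * length M)              ≡⟨ ≡.cong suc (*-suc 2 (length M)) ⟨
      suc (2 * suc (length M))            ≡⟨ ≡.cong (λ m → suc (2 * suc m)) (length-map (relabelEdge i) M) ⟨
      suc (2 * length (insertFirst M i))  ∎
      where open ≡.≡-Reasoning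

    SeqEntries : Matching → Set ℓ
    SeqEntries M = ∀ j → 1 ≤ j → j ≤ suc (2 * length M) → nth j (seq α β M) ≈ s α β M ∙ gapWeight M j

    -- Gap j + 1 ≤ i + 1 of insertFirst M i comes from gap j of M and gains a crossing with
    -- the new edge; gap i + k + 2 comes from gap i + k and gains a nesting.
    SeqEntries-insertFirst : ∀ {M i} → Grown M → 1 ≤ i → i ≤ suc (2 * length M) → SeqEntries M →
                             SeqEntries (insertFirst M i)
    SeqEntries-insertFirst {M} {i} g 1≤i i≤ entries j 1≤j j≤ =
      ≈-trans (reflexive (≡.cong (nth j) (seq-insertFirst M i))) (entry j 1≤j (≡.subst (λ m → j ≤ suc m) 2|N| j≤))
      where
      xs : List C
      xs = seq α β M
      N : Matching
      N = insertFirst M i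
      2|N| : 2 * length N ≡ 2 + 2 * length M
      2|N| = ≡.trans (≡.cong (2 *_) (≡.cong suc (length-map (relabelEdge i) M))) (*-suc 2 (length M))
      i≤|xs| : i ≤ length xs
      i≤|xs| = ≡.subst (i ≤_) (≡.sym (length-seq g)) i≤
      xᵢ≈ : nth i xs ≈ s α β M ∙ gapWeight M i
      xᵢ≈ = entries i 1≤i i≤
      x₁≈ : nth 1 xs ≈ s α β M
      x₁≈ = ≈-trans (entries 1 (s≤s z≤n) (s≤s z≤n)) (≈-trans (∙-congˡ (gapWeight-1 (Grown⇒Positive g))) (identityʳ _))
      sN≈ : s α β N ≈ s α β M ∙ gapWeight M i
      sN≈ = s-insertFirst M i (Grown⇒Positive g)
      entry : ∀ j → 1 ≤ j → j ≤ 3 + 2 * length M → nth j (R α β i xs) ≈ s α β N ∙ gapWeight N j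
      entry (suc zero) _ _ =
        ≈-trans xᵢ≈ (≈-trans (≈-sym sN≈) (≈-sym (≈-trans (∙-congˡ (gapWeight-1 (insertFirst-positive M i))) (identityʳ _))))
      entry (suc (suc j)) _ j≤ with ≤-<-connex (suc j) i
      ... | inj₁ j<i
        rewrite nth-R-< α β i xs j j<i i≤|xs|
              | straddles-insertFirst-≤ {i} {suc j} (s≤s z≤n) j<i M | before-insertFirst-≤ {i} {suc j} 1≤i j<i M =
        ≈-trans (∙-congʳ (entries (suc j) (s≤s z≤n) (≤-trans j<i i≤)))
                (≈-trans (rebase α xᵢ≈ x₁≈) (∙-cong (≈-sym sN≈) (≈-sym (assoc α _ _))))
      ... | inj₂ i≤j with m≤n⇒∃[o]m+o≡n (≤-pred i≤j)
      ...   | k , ≡.refl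
        rewrite nth-R-≥ α β i xs k 1≤i (≡.subst (i + k ≤_) (≡.sym (length-seq g)) (≤-pred (≤-pred j≤)))
              | straddles-insertFirst-≥ {i} {i + k} (m≤m+n i k) M | before-insertFirst-≥ {i} {i + k} 1≤i (m≤m+n i k) M =
        ≈-trans (∙-congʳ (entries (i + k) (≤-trans 1≤i (m≤m+n i k)) (≤-pred (≤-pred j≤))))
                (≈-trans (rebase β xᵢ≈ x₁≈) (∙-cong (≈-sym sN≈) (x∙yz≈y∙xz β _ _)))

    seqEntries : ∀ {M} → Grown M → SeqEntries M
    seqEntries empty (suc zero) _ _ =
      ≈-sym (≈-trans (∙-cong (identityˡ ε) (identityˡ ε)) (identityˡ ε))
    seqEntries empty (suc (suc j)) _ (s≤s ())
    seqEntries (grow g 1≤i i≤) = SeqEntries-insertFirst g 1≤i i≤ (seqEntries g)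

    head-seq : ∀ {M} → Grown M → nth 1 (seq α β M) ≈ s α β M
    head-seq {M} g = ≈-trans (seqEntries g 1 (s≤s z≤n) (s≤s z≤n))
                             (≈-trans (∙-congˡ (gapWeight-1 (Grown⇒Positive g))) (identityʳ _))

    map-positions : ∀ (f : ℕ → C) xs → (∀ j → 1 ≤ j → j ≤ length xs → f j ≈ nth j xs) → map f (positions (length xs)) ≋ xs
    map-positions f []       f≈ = []
    map-positions f (x ∷ xs) f≈ = ≋-trans (≋-reflexive (≡.cong (map f) (positions-suc (length xs))))
      (f≈ 1 (s≤s z≤n) (s≤s z≤n) ∷ ≋-trans (≋-reflexive (≡.sym (map-∘ (positions (length xs)))))
        (map-positions (f ∘ suc) xs (λ { (suc j) _ j≤n → f≈ (suc (suc j)) (s≤s z≤n) (s≤s j≤n) })))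

    children-seq : ∀ {M} → Grown M → map (s α β) (children M) ≋ seq α β M
    children-seq {M} g = ≋-trans (≋-reflexive children≡)
      (map-positions (s α β ∘ insertFirst M) (seq α β M)
        (λ j 1≤j j≤ → ≈-trans (s-insertFirst M j (Grown⇒Positive g))
                              (≈-sym (seqEntries g j 1≤j (≡.subst (j ≤_) |seq| j≤)))))
      where
      |seq| : length (seq α β M) ≡ suc (2 * length M)
      |seq| = length-seq g
      children≡ : map (s α β) (children M) ≡ map (s α β ∘ insertFirst M) (positions (length (seq α β M)))
      children≡ = ≡.trans (≡.sym (map-∘ (gaps M))) (≡.cong (λ n → map (s α β ∘ insertFirst M) (positions n)) (≡.sym |seq|))

    levelsR : ℕ → List C → List C
    levelsR zero    xs = xs
    levelsR (suc l) xs = concatMap (λ i → levelsR l (R α β i xs)) (positions (length xs))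

    T-levelsR : ∀ l {M} → Grown M → map (s α β) (T M (suc l)) ≋ levelsR l (seq α β M)
    T-levelsR zero    {M} g = ≋-trans (≋-reflexive (≡.cong (map (s α β)) (++-identityʳ (children M)))) (children-seq g)
    T-levelsR (suc l) {M} g = begin
      map (s α β) (T M (2 + l))
        ≡⟨ ≡.trans (≡.cong (map (s α β)) (T-suc M (suc l))) (map-concatMap (s α β) (λ N → T N (suc l)) (children M)) ⟩
      concatMap (λ N → map (s α β) (T N (suc l))) (map (insertFirst M) (gaps M))
        ≡⟨ concatMap-map (λ N → map (s α β) (T N (suc l))) (insertFirst M) (gaps M) ⟩
      concatMap (λ j → map (s α β) (T (insertFirst M j) (suc l))) (gaps M)
        ≈⟨ concatMap⁺-≋-All (All-positions (suc (2 * length M)))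
             (λ (1≤j , j≤) → ≋-trans (T-levelsR l (grow g 1≤j j≤)) (≋-reflexive (≡.cong (levelsR l) (seq-insertFirst M _)))) ⟩
      concatMap (λ j → levelsR l (R α β j (seq α β M))) (positions (suc (2 * length M)))
        ≡⟨ ≡.cong (λ n → concatMap (λ j → levelsR l (R α β j (seq α β M))) (positions n)) (length-seq g) ⟨
      levelsR (suc l) (seq α β M) ∎
      where open import Relation.Binary.Reasoning.Setoid ≋-setoid

    R-child : ∀ {h xs} ys → xs ≋ shift h ys → nth 1 ys ≈ ε → ∀ i →
              R α β i xs ≋ shift (nth i xs) (child α β (pivotAt ys i))
    R-child [] [] _ i rewrite take-[] {A = C} i | drop-[] {A = C} (i ∸ 1) = ≈-sym (identityˡ ε) ∷ []
    R-child {h} {xs} ys@(y₁ ∷ _) xs≋@(x₁≈ ∷ _) y₁≈ε i =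
      ≈-sym (identityˡ xᵢ) ∷ ≋-trans
        (++⁺-≋ (shift-rebase α (take i ys) (≋-trans (take⁺ i xs≋) (≋-reflexive (take-map i ys))) (cancel α))
               (shift-rebase β (drop (i ∸ 1) ys) (≋-trans (drop⁺ (i ∸ 1) xs≋) (≋-reflexive (drop-map (i ∸ 1) ys))) (cancel β)))
        (≋-reflexive (≡.sym (map-++ (_∙ xᵢ) (α · take i ys) (β · drop (i ∸ 1) ys))))
      where
      xᵢ : C
      xᵢ = nth i xs
      cancel : ∀ a → (xᵢ ∙ nth 1 xs ⁻¹) ∙ a ≈ (xᵢ ∙ h ⁻¹) ∙ a
      cancel a = ∙-congʳ (∙-congˡ (⁻¹-cong (≈-trans x₁≈ (≈-trans (∙-congʳ y₁≈ε) (identityˡ h)))))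

    levelsR-levels : ∀ l {h xs} ys → xs ≋ shift h ys → nth 1 ys ≈ ε → levelsR l xs ≋ shift h (levels α β l ys)
    levelsR-levels zero    ys xs≋ _ = xs≋
    levelsR-levels (suc l) {h} {xs} ys xs≋ y₁≈ε = begin
      concatMap (λ i → levelsR l (R α β i xs)) (positions (length xs))
        ≡⟨ ≡.cong (λ n → concatMap (λ i → levelsR l (R α β i xs)) (positions n)) |xs|≡|ys| ⟩
      concatMap (λ i → levelsR l (R α β i xs)) (positions (length ys))
        ≈⟨ concatMap⁺-≋-All (All-positions (length ys)) (λ {i} (1≤i , i≤n) → ≋-trans
             (levelsR-levels l (child α β (pivotAt ys i)) (R-child ys xs≋ y₁≈ε i) ≈-refl)
             (shift-· (levels α β l (child α β (pivotAt ys i))) (xᵢ≈ i 1≤i i≤n))) ⟩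
      concatMap (λ i → shift h (step (pivotAt ys i))) (positions (length ys))
        ≡⟨ map-concatMap (_∙ h) (step ∘ pivotAt ys) (positions (length ys)) ⟨
      shift h (concatMap (step ∘ pivotAt ys) (positions (length ys)))
        ≡⟨ ≡.cong (shift h) levels-suc ⟨
      shift h (levels α β (suc l) ys) ∎
      where
      open import Relation.Binary.Reasoning.Setoid ≋-setoid
      step : Pivot → List C
      step p = pivot p · levels α β l (child α β p)
      levels-suc : levels α β (suc l) ys ≡ concatMap (step ∘ pivotAt ys) (positions (length ys))
      levels-suc = ≡.trans (≡.cong (concatMap step) (pivots-positions ys)) (concatMap-map step (pivotAt ys) (positions (length ys)))
      |xs|≡|ys| : length xs ≡ length ys
      |xs|≡|ys| = ≡.trans (≋-length xs≋) (length-map _ ys)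
      xᵢ≈ : ∀ i → 1 ≤ i → i ≤ length ys → nth i xs ≈ nth i ys ∙ h
      xᵢ≈ (suc j) _ j<n = ≈-trans (nth-cong (suc j) xs≋) (reflexive (nth-shift j h ys j<n))

  normalisedSeq : C → C → Matching → List C
  normalisedSeq a b M = shift (s a b M ⁻¹) (seq a b M)

  T-closedForm : ∀ a b l {M} → Grown M →
                 map (s a b) (T M (suc l)) ↭ shift (s a b M) (closedForm a b l (normalisedSeq a b M))
  T-closedForm a b l {M} g = ↭-trans
    (↭-reflexive-≋ (≋-trans (T-levelsR a b l g) (levelsR-levels a b l (normalisedSeq a b M) (shift-shift⁻¹ h xs) head≈ε)))
    (shift⁺ ≈-refl (levels-closedForm a b l (normalisedSeq a b M)))
    where
    xs : List C
    xs = seq a b M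
    h : C
    h = s a b M
    head≈ε : nth 1 (shift (h ⁻¹) xs) ≈ ε
    head≈ε = ≈-trans (reflexive (nth-shift 0 (h ⁻¹) xs (≡.subst (1 ≤_) (≡.sym (length-seq a b g)) (s≤s z≤n))))
                     (≈-trans (∙-congʳ (head-seq a b g)) (inverseʳ h))

  singleton-↭ : ∀ {x y} → x ∷ [] ↭ y ∷ [] → x ≈ y
  singleton-↭ x↭y with ∈-resp-↭ x↭y (here ≈-refl)
  ... | here x≈y = x≈y

  tree-statistics-⇔ : ∀ a b a′ b′ → (∀ l ys → closedForm a b l ys ↭ closedForm a′ b′ l ys) →
    ∀ {M N} → Grown M → Grown N →
    (∀ l → map (s a b) (T M l) ↭ map (s a′ b′) (T N l)) ⇔ (s a b M ≈ s a′ b′ N × seq a b M ↭ seq a′ b′ N)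
  tree-statistics-⇔ a b a′ b′ same {M} {N} gM gN = mk⇔ to from
    where
    to : (∀ l → map (s a b) (T M l) ↭ map (s a′ b′) (T N l)) → s a b M ≈ s a′ b′ N × seq a b M ↭ seq a′ b′ N
    to T↭ = singleton-↭ (T↭ 0) ,
            ↭-trans (↭-sym (↭-reflexive-≋ (T-levelsR a b 0 gM))) (↭-trans (T↭ 1) (↭-reflexive-≋ (T-levelsR a′ b′ 0 gN)))
    from : s a b M ≈ s a′ b′ N × seq a b M ↭ seq a′ b′ N → ∀ l → map (s a b) (T M l) ↭ map (s a′ b′) (T N l)
    from (s≈ , seq↭) zero    = prep s≈ ↭-refl
    from (s≈ , seq↭) (suc l) = begin
      map (s a b) (T M (suc l))
        ↭⟨ T-closedForm a b l gM ⟩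
      shift (s a b M) (closedForm a b l (normalisedSeq a b M))
        ↭⟨ shift⁺ ≈-refl (closedForm-↭ a b l (shift⁺ (⁻¹-cong s≈) seq↭)) ⟩
      shift (s a b M) (closedForm a b l (normalisedSeq a′ b′ N))
        ↭⟨ shift⁺ s≈ (same l (normalisedSeq a′ b′ N)) ⟩
      shift (s a′ b′ N) (closedForm a′ b′ l (normalisedSeq a′ b′ N))
        ↭⟨ T-closedForm a′ b′ l gN ⟨
      map (s a′ b′) (T N (suc l)) ∎
      where open PermutationReasoning

open import Data.List.Relation.Binary.Permutation.Setoid using (_↭_)

theorem2p7 : ∀ {c ℓ} (G : AbelianGroup c ℓ) (α β : AbelianGroup.Carrier G) (n : ℕ) (M N : Matching) → IsMatching n M → IsMatching n N → (((∀ (l : ℕ) → _↭_ (AbelianGroup.setoid G) (map (WithGroup.s G α β) (T M l)) (map (WithGroup.s G α β) (T N l))) ⇔ (AbelianGroup._≈_ G (WithGroup.s G α β M) (WithGroup.s G α β N) × _↭_ (AbelianGroup.setoid G) (WithGroup.seq G α β M) (WithGroup.seq G α β N))) × ((∀ (l : ℕ) → _↭_ (AbelianGroup.setoid G) (map (WithGroup.s G α β) (T M l)) (map (WithGroup.s G β α) (T N l))) ⇔ (AbelianGroup._≈_ G (WithGroup.s G α β M) (WithGroup.s G β α N) × _↭_ (AbelianGroup.setoid G) (WithGroup.seq G α β M) (WithGroup.seq G β α N))))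
theorem2p7 G α β n M N M∈𝓜 N∈𝓜 =
  tree-statistics-⇔ α β α β (λ _ _ → ↭-refl) M-grown N-grown ,
  tree-statistics-⇔ α β β α (closedForm-swap α β) M-grown N-grown
  where
  open Statistics G
  open Multisets G using (closedForm-swap)
  open import Data.List.Relation.Binary.Permutation.Setoid (AbelianGroup.setoid G) using (↭-refl)
  M-grown : Grown M
  M-grown = IsMatching⇒Grown n M M∈𝓜
  N-grown : Grown N
  N-grown = IsMatching⇒Grown n N N∈𝓜
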